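{- Let $T$ be a finite rooted tree and $e$ an edge of $T$. Let $T_-$ be the component of $T-e$ containing the root (a rooted tree, rooted at the root of $T$), $U_+$ the other component (an unrooted tree), and $v_-\in T_-$, $v_+\in U_+$ the endpoints of $e$. Then $$\frac{m_T(e)}{\mathrm{Aut}_r(T)}=\frac{m_{T_- }(v_-)\,n_{U_+}(v_+)}{\mathrm{Aut}_r(T_-)\,\mathrm{Aut}_u(U_+)}.$$
   Context: $\mathrm{Aut}_r(T)$ is the number of automorphisms of the rooted tree $T$ that fix the root; $\mathrm{Aut}_u(U)$ is the number of automorphisms of the unrooted tree $U$. $m_T(e)$ is the number of distinct edges of $T$ mapped to $e$ by some root-fixing automorphism of $T$; $m_{T_- }(v_-)$ is the number of distinct vertices of $T_-$ mapped to $v_-$ by some root-fixing automorphism of $T_-$; $n_{U_+}(v_+)$ is the number of distinct vertices of $U_+$ mapped to $v_+$ by some automorphism of $U_+$. -}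

module Defs where

open import Data.Nat using (ℕ; zero; suc; _∸_; _*_)
open import Data.Bool using (Bool; true; false; _∧_; _∨_; not; if_then_else_)
open import Data.Fin using (Fin; toℕ; _≟_)
open import Data.Vec using (Vec; []; _∷_; lookup)
open import Data.List using (List; []; _∷_; [_]; map; concatMap; allFin; filterᵇ; length)
open import Data.Bool.ListAction using (all; any)
open import Relation.Nullary.Decidable using (⌊_⌋)
open import Relation.Binary.PropositionalEquality using (_≡_)
open import Data.Product using (_×_; _,_; proj₁; proj₂)
import Data.Nat as ℕ

∀F : ∀ {n} → (Fin n → Bool) → Bool
∀F {n} p = all p (allFin n)

∃F : ∀ {n} → (Fin n → Bool) → Bool
∃F {n} p = any p (allFin n)

countF : ∀ {n} → (Fin n → Bool) → ℕ
countF {n} p = length (filterᵇ p (allFin n))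

_==_ : ∀ {n} → Fin n → Fin n → Bool
i == j = ⌊ i ≟ j ⌋

_⇒_ : Bool → Bool → Bool
a ⇒ b = not a ∨ b

_<F_ : ∀ {n} → Fin n → Fin n → Bool
i <F j = ⌊ toℕ i ℕ.<? toℕ j ⌋

-- All maps Fin n → Fin n, tabulated as vectors (so that equality of maps
-- is intensional and the collection is a finite list).

allVec : ∀ n m → List (Vec (Fin n) m)
allVec n zero    = [ [] ]
allVec n (suc m) = concatMap (λ x → map (x ∷_) (allVec n m)) (allFin n)

Map : ℕ → Set
Map n = Vec (Fin n) n

allMaps : ∀ n → List (Map n)
allMaps n = allVec n n

countMaps : ∀ {n} → (Map n → Bool) → ℕ
countMaps {n} p = length (filterᵇ p (allMaps n))

∃Map : ∀ {n} → (Map n → Bool) → Bool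
∃Map {n} p = any p (allMaps n)

record Graph (n : ℕ) : Set where
  field
    adj   : Fin n → Fin n → Bool
    sym   : ∀ i j → adj i j ≡ adj j i
    irrefl : ∀ i → adj i i ≡ false
open Graph public

countPairs : ∀ {n} → (Fin n → Fin n → Bool) → ℕ
countPairs {n} p = length (filterᵇ (λ ij → p (proj₁ ij) (proj₂ ij))
                      (concatMap (λ i → map (i ,_) (allFin n)) (allFin n)))

edgeCount : ∀ {n} → Graph n → ℕ
edgeCount G = countPairs (λ i j → (i <F j) ∧ adj G i j)

sameEdge : ∀ {n} → Fin n → Fin n → Fin n → Fin n → Bool
sameEdge i j a b = ((i == a) ∧ (j == b)) ∨ ((i == b) ∧ (j == a))

reach : ∀ {n} → ℕ → (Fin n → Fin n → Bool) → Fin n → Fin n → Bool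
reach zero    A u v = u == v
reach (suc k) A u v = reach k A u v ∨ ∃F (λ w → reach k A u w ∧ A w v)

-- reachability (paths have < n steps, so n steps suffice)
reachable : ∀ {n} → (Fin n → Fin n → Bool) → Fin n → Fin n → Bool
reachable {n} A = reach n A

Connected : ∀ {n} → Graph n → Set
Connected {n} G = ∀ (i j : Fin n) → reachable (adj G) i j ≡ true

IsTree : ∀ {n} → Graph n → Set
IsTree {n} G = Connected G × edgeCount G ≡ n ∸ 1

adjMinus : ∀ {n} → Graph n → Fin n → Fin n → Fin n → Fin n → Bool
adjMinus G a b i j = adj G i j ∧ not (sameEdge i j a b)

_⇔ᵇ_ : Bool → Bool → Bool
x ⇔ᵇ y = (x ⇒ y) ∧ (y ⇒ x)

-- Automorphisms of the induced subgraph of (Fin n, A) on the vertex set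
-- S ⊆ Fin n.  Such an automorphism is encoded (uniquely) as a map
-- σ : Fin n → Fin n that is the identity outside S, maps S into S,
-- is injective (hence restricts to a bijection of S) and preserves and
-- reflects adjacency between vertices of S.

isAutOn : ∀ {n} → (Fin n → Fin n → Bool) → (Fin n → Bool) → Map n → Bool
isAutOn A S σ = ∀F (λ i →
     (not (S i) ⇒ (lookup σ i == i))
   ∧ (S i ⇒ S (lookup σ i))
   ∧ ∀F (λ j →
        ((lookup σ i == lookup σ j) ⇒ (i == j))
      ∧ ((S i ∧ S j) ⇒ (A (lookup σ i) (lookup σ j) ⇔ᵇ A i j))))

isAutROn : ∀ {n} → (Fin n → Fin n → Bool) → (Fin n → Bool) → Fin n → Map n → Bool
isAutROn A S r σ = isAutOn A S σ ∧ (lookup σ r == r)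

AutR : ∀ {n} → (Fin n → Fin n → Bool) → (Fin n → Bool) → Fin n → ℕ
AutR A S r = countMaps (isAutROn A S r)

AutU : ∀ {n} → (Fin n → Fin n → Bool) → (Fin n → Bool) → ℕ
AutU A S = countMaps (isAutOn A S)

mVert : ∀ {n} → (Fin n → Fin n → Bool) → (Fin n → Bool) → Fin n → Fin n → ℕ
mVert A S r v = countF (λ w → S w ∧ ∃Map (λ σ → isAutROn A S r σ ∧ (lookup σ w == v)))

nVert : ∀ {n} → (Fin n → Fin n → Bool) → (Fin n → Bool) → Fin n → ℕ
nVert A S v = countF (λ w → S w ∧ ∃Map (λ σ → isAutOn A S σ ∧ (lookup σ w == v)))

full : ∀ {n} → Fin n → Bool
full _ = true

mEdge : ∀ {n} → Graph n → Fin n → Fin n → Fin n → ℕ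
mEdge G r a b = countPairs (λ c d → (c <F d) ∧ adj G c d
   ∧ ∃Map (λ σ → isAutROn (adj G) full r σ ∧ sameEdge (lookup σ c) (lookup σ d) a b))

Sminus : ∀ {n} → Graph n → Fin n → Fin n → Fin n → Fin n → Bool
Sminus G r a b = reachable (adjMinus G a b) r

Splus : ∀ {n} → Graph n → Fin n → Fin n → Fin n → Fin n → Bool
Splus G r a b v = not (Sminus G r a b v)

vminus : ∀ {n} → Graph n → Fin n → Fin n → Fin n → Fin n
vminus G r a b = if Sminus G r a b a then a else b

vplus : ∀ {n} → Graph n → Fin n → Fin n → Fin n → Fin n
vplus G r a b = if Sminus G r a b a then b else a

-- Orbit–stabilizer gives m_T(e) · |Stab(e)| = Aut_r(T), m_{T₋}(v₋) · |Stab(v₋)| = Aut_r(T₋) and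
-- n_{U₊}(v₊) · |Stab(v₊)| = Aut_u(U₊), so it suffices that |Stab(e)| = |Stab(v₋)| · |Stab(v₊)|.
-- A root-fixing automorphism of T that maps e to itself preserves T₋, the component of the root
-- in T − e, hence cannot swap v₋ and v₊; it therefore restricts to automorphisms of T₋ and U₊
-- fixing v₋ and v₊, and conversely any two such automorphisms glue to one of T.
-- That T − e is disconnected at all is where T being a tree enters: otherwise T − e would be a
-- connected graph on n vertices with only n − 2 edges.

module Submission where

open import Defs hiding (sym)
open import Data.Nat using (ℕ; zero; suc; _+_; _*_; _∸_; _≤_; _<_; _<?_; _≤?_; z≤n; s≤s; pred)
open import Data.Nat.Properties
open import Data.Bool using (Bool; true; false; _∧_; _∨_; not; if_then_else_) renaming (_≟_ to _≟ᵇ_)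
open import Data.Bool.Properties using (¬-not; ∨-comm)
open import Data.Fin using (Fin; zero; suc; toℕ; punchOut)
import Data.Fin as Fin
import Data.Fin.Properties as Finₚ
open import Data.Vec using (Vec; []; _∷_; lookup; tabulate)
open import Data.Vec.Properties using (lookup∘tabulate; tabulate∘lookup; tabulate-cong)
open import Data.List using (List; []; _∷_; map; concatMap; allFin; filterᵇ; length; _++_)
open import Data.List.Membership.Propositional using (_∈_)
open import Data.List.Membership.Propositional.Properties using (∈-allFin; ∈-map⁺; ∈-concatMap⁺)
open import Data.List.Relation.Unary.Any as Any using (here; there)
import Data.List as List
import Data.List.Properties as Listₚ
open import Data.Bool.ListAction using (all; any)
open import Data.Product using (Σ; ∃; _×_; _,_; proj₁; proj₂)
open import Data.Sum using (_⊎_; inj₁; inj₂; [_,_]′)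
open import Data.Empty using (⊥; ⊥-elim)
open import Relation.Nullary using (Dec; yes; no; ¬_)
open import Relation.Nullary.Decidable using (⌊_⌋)
open import Relation.Binary.PropositionalEquality
open import Relation.Binary.Definitions using (tri<; tri≈; tri>)
open import Function using (_∘_; id)
open import Data.Nat.Solver using (module +-*-Solver)
open import Algebra.Properties.CommutativeSemigroup +-commutativeSemigroup
  using () renaming (interchange to +-interchange)

private variable
  A B : Set

⟦_⟧ : Bool → ℕ
⟦ true ⟧ = 1
⟦ false ⟧ = 0

true-or-false : ∀ x → (x ≡ true) ⊎ (x ≡ false)
true-or-false true = inj₁ refl
true-or-false false = inj₂ refl

contradictionᵇ : ∀ {x} → x ≡ true → x ≡ false → A
contradictionᵇ refl ()

≢true⇒false : ∀ {x} → ¬ (x ≡ true) → x ≡ false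
≢true⇒false = ¬-not

bool-ext : ∀ {x y : Bool} → (x ≡ true → y ≡ true) → (y ≡ true → x ≡ true) → x ≡ y
bool-ext {true} {true} f g = refl
bool-ext {true} {false} f g = sym (f refl)
bool-ext {false} {true} f g = g refl
bool-ext {false} {false} f g = refl

∧-trueˡ : ∀ {x y} → x ∧ y ≡ true → x ≡ true
∧-trueˡ {true} e = refl

∧-trueʳ : ∀ x {y} → x ∧ y ≡ true → y ≡ true
∧-trueʳ true e = e

∧-true : ∀ {x y} → x ≡ true → y ≡ true → x ∧ y ≡ true
∧-true refl refl = refl

∧-falseˡ : ∀ {x} y → x ≡ false → x ∧ y ≡ false
∧-falseˡ y refl = refl

∧-trueˡ-identity : ∀ {x} y → x ≡ true → x ∧ y ≡ y
∧-trueˡ-identity y refl = refl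

∨-true⁻ : ∀ x {y} → x ∨ y ≡ true → (x ≡ true) ⊎ (y ≡ true)
∨-true⁻ true e = inj₁ refl
∨-true⁻ false e = inj₂ e

∨-trueˡ : ∀ {x} y → x ≡ true → x ∨ y ≡ true
∨-trueˡ y refl = refl

∨-trueʳ : ∀ x {y} → y ≡ true → x ∨ y ≡ true
∨-trueʳ true e = refl
∨-trueʳ false e = e

not-true⁻ : ∀ {x} → not x ≡ true → x ≡ false
not-true⁻ {false} e = refl

not-false⁻ : ∀ {x} → not x ≡ false → x ≡ true
not-false⁻ {true} e = refl

not-true : ∀ {x} → x ≡ false → not x ≡ true
not-true refl = refl

⇒-true⁻ : ∀ {x y} → (x ⇒ y) ≡ true → x ≡ true → y ≡ true
⇒-true⁻ {true} e refl = e

⇒-true : ∀ {x y} → (x ≡ true → y ≡ true) → (x ⇒ y) ≡ true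
⇒-true {true} f = f refl
⇒-true {false} f = refl

⇔ᵇ-true⁻ : ∀ {x y} → (x ⇔ᵇ y) ≡ true → x ≡ y
⇔ᵇ-true⁻ {true} {true} e = refl
⇔ᵇ-true⁻ {false} {false} e = refl

⇔ᵇ-true : ∀ {x y} → x ≡ y → (x ⇔ᵇ y) ≡ true
⇔ᵇ-true {true} refl = refl
⇔ᵇ-true {false} refl = refl

⟦∧⟧ : ∀ x y → ⟦ x ∧ y ⟧ ≡ ⟦ x ⟧ * ⟦ y ⟧
⟦∧⟧ true y = sym (+-identityʳ ⟦ y ⟧)
⟦∧⟧ false y = refl

⟦⟧+⟦not⟧ : ∀ x → ⟦ x ⟧ + ⟦ not x ⟧ ≡ 1
⟦⟧+⟦not⟧ true = refl
⟦⟧+⟦not⟧ false = refl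

if-true : ∀ {c : Bool} (x y : A) → c ≡ true → (if c then x else y) ≡ x
if-true x y refl = refl

if-false : ∀ {c : Bool} (x y : A) → c ≡ false → (if c then x else y) ≡ y
if-false x y refl = refl

dec-true⁻ : ∀ {P : Set} (d : Dec P) → ⌊ d ⌋ ≡ true → P
dec-true⁻ (yes p) _ = p

dec-true : ∀ {P : Set} (d : Dec P) → P → ⌊ d ⌋ ≡ true
dec-true (yes p) _ = refl
dec-true (no ¬p) p = ⊥-elim (¬p p)

==⇒≡ : ∀ {n} {i j : Fin n} → i == j ≡ true → i ≡ j
==⇒≡ {i = i} {j} = dec-true⁻ (i Fin.≟ j)

≡⇒== : ∀ {n} {i j : Fin n} → i ≡ j → i == j ≡ true
≡⇒== {i = i} {j} = dec-true (i Fin.≟ j)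

==-refl : ∀ {n} (i : Fin n) → i == i ≡ true
==-refl i = ≡⇒== refl

≢⇒==false : ∀ {n} {i j : Fin n} → i ≢ j → i == j ≡ false
≢⇒==false p = ≢true⇒false (p ∘ ==⇒≡)

==-suc : ∀ {n} (i j : Fin n) → (suc i == suc j) ≡ (i == j)
==-suc i j = bool-ext (≡⇒== ∘ Finₚ.suc-injective ∘ ==⇒≡) (≡⇒== ∘ cong suc ∘ ==⇒≡)

<F⇒< : ∀ {n} {i j : Fin n} → i <F j ≡ true → toℕ i < toℕ j
<F⇒< {i = i} {j} = dec-true⁻ (toℕ i <? toℕ j)

<F-asym : ∀ {n} {i j : Fin n} → i <F j ≡ true → j <F i ≡ true → ⊥
<F-asym p q = <-asym (<F⇒< p) (<F⇒< q)

<F-connex : ∀ {n} {i j : Fin n} → i ≢ j → (i <F j ≡ true) ⊎ (j <F i ≡ true)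
<F-connex {i = i} {j} i≢j with Finₚ.<-cmp i j
... | tri< i<j _ _ = inj₁ (dec-true (toℕ i <? toℕ j) i<j)
... | tri≈ _ i≡j _ = ⊥-elim (i≢j i≡j)
... | tri> _ _ j<i = inj₂ (dec-true (toℕ j <? toℕ i) j<i)

∑ : List A → (A → ℕ) → ℕ
∑ [] f = 0
∑ (x ∷ xs) f = f x + ∑ xs f

length-filterᵇ : (p : A → Bool) (xs : List A) → length (filterᵇ p xs) ≡ ∑ xs (λ x → ⟦ p x ⟧)
length-filterᵇ p [] = refl
length-filterᵇ p (x ∷ xs) with p x
... | true = cong suc (length-filterᵇ p xs)
... | false = length-filterᵇ p xs

∑-cong : (xs : List A) {f g : A → ℕ} → (∀ x → f x ≡ g x) → ∑ xs f ≡ ∑ xs g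
∑-cong [] e = refl
∑-cong (x ∷ xs) e = cong₂ _+_ (e x) (∑-cong xs e)

∑-zero : (xs : List A) {f : A → ℕ} → (∀ x → f x ≡ 0) → ∑ xs f ≡ 0
∑-zero [] e = refl
∑-zero (x ∷ xs) e = cong₂ _+_ (e x) (∑-zero xs e)

∑-mono : (xs : List A) {f g : A → ℕ} → (∀ x → f x ≤ g x) → ∑ xs f ≤ ∑ xs g
∑-mono [] e = z≤n
∑-mono (x ∷ xs) e = +-mono-≤ (e x) (∑-mono xs e)

∑-+ : (xs : List A) (f g : A → ℕ) → ∑ xs (λ x → f x + g x) ≡ ∑ xs f + ∑ xs g
∑-+ [] f g = refl
∑-+ (x ∷ xs) f g = trans (cong (f x + g x +_) (∑-+ xs f g)) (+-interchange (f x) (g x) (∑ xs f) (∑ xs g))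

∑-*ˡ : (xs : List A) (c : ℕ) (f : A → ℕ) → ∑ xs (λ x → c * f x) ≡ c * ∑ xs f
∑-*ˡ [] c f = sym (*-zeroʳ c)
∑-*ˡ (x ∷ xs) c f = trans (cong (c * f x +_) (∑-*ˡ xs c f)) (sym (*-distribˡ-+ c (f x) (∑ xs f)))

∑-*ʳ : (xs : List A) (c : ℕ) (f : A → ℕ) → ∑ xs (λ x → f x * c) ≡ ∑ xs f * c
∑-*ʳ xs c f = trans (∑-cong xs (λ x → *-comm (f x) c)) (trans (∑-*ˡ xs c f) (*-comm c (∑ xs f)))

∑-++ : (xs ys : List A) (f : A → ℕ) → ∑ (xs ++ ys) f ≡ ∑ xs f + ∑ ys f
∑-++ [] ys f = refl
∑-++ (x ∷ xs) ys f = trans (cong (f x +_) (∑-++ xs ys f)) (sym (+-assoc (f x) _ _))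

∑-map : (g : B → A) (xs : List B) (f : A → ℕ) → ∑ (map g xs) f ≡ ∑ xs (f ∘ g)
∑-map g [] f = refl
∑-map g (x ∷ xs) f = cong (f (g x) +_) (∑-map g xs f)

∑-concatMap : (g : B → List A) (xs : List B) (f : A → ℕ) →
  ∑ (concatMap g xs) f ≡ ∑ xs (λ x → ∑ (g x) f)
∑-concatMap g [] f = refl
∑-concatMap g (x ∷ xs) f = trans (∑-++ (g x) (concatMap g xs) f) (cong (∑ (g x) f +_) (∑-concatMap g xs f))

∑-swap : (xs : List A) (ys : List B) (f : A → B → ℕ) →
  ∑ xs (λ x → ∑ ys (f x)) ≡ ∑ ys (λ y → ∑ xs (λ x → f x y))
∑-swap [] ys f = sym (∑-zero ys (λ _ → refl))
∑-swap (x ∷ xs) ys f = trans (cong (∑ ys (f x) +_) (∑-swap xs ys f)) (sym (∑-+ ys (f x) _))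

any-false⇒∑≡0 : (p : A → Bool) (xs : List A) → any p xs ≡ false → ∑ xs (λ x → ⟦ p x ⟧) ≡ 0
any-false⇒∑≡0 p [] e = refl
any-false⇒∑≡0 p (x ∷ xs) e with p x
... | false = any-false⇒∑≡0 p xs e

any-true⁻ : (p : A → Bool) (xs : List A) → any p xs ≡ true → ∃ λ x → p x ≡ true
any-true⁻ p (x ∷ xs) e with true-or-false (p x)
... | inj₁ px = x , px
... | inj₂ px rewrite px = any-true⁻ p xs e

any-true : (p : A → Bool) {xs : List A} {x : A} → x ∈ xs → p x ≡ true → any p xs ≡ true
any-true p {x ∷ xs} (here refl) px rewrite px = refl
any-true p {y ∷ xs} (there x∈xs) px = ∨-trueʳ (p y) (any-true p x∈xs px)

all-true⁻ : (p : A → Bool) {xs : List A} {x : A} → all p xs ≡ true → x ∈ xs → p x ≡ true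
all-true⁻ p e (here refl) = ∧-trueˡ e
all-true⁻ p {y ∷ xs} e (there x∈xs) = all-true⁻ p (∧-trueʳ (p y) e) x∈xs

all-true : (p : A → Bool) (xs : List A) → (∀ x → p x ≡ true) → all p xs ≡ true
all-true p [] f = refl
all-true p (x ∷ xs) f = ∧-true (f x) (all-true p xs f)

∑F : ∀ {n} → (Fin n → ℕ) → ℕ
∑F {n} f = ∑ (allFin n) f

countF≡∑F : ∀ {n} (p : Fin n → Bool) → countF p ≡ ∑F (λ i → ⟦ p i ⟧)
countF≡∑F {n} p = length-filterᵇ p (allFin n)

∑F-suc : ∀ {n} (f : Fin (suc n) → ℕ) → ∑F f ≡ f zero + ∑F (f ∘ suc)
∑F-suc {n} f = cong (f zero +_) (begin
  ∑ (List.tabulate suc) f          ≡⟨ cong (λ xs → ∑ xs f) (Listₚ.map-tabulate id suc) ⟨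
  ∑ (map suc (allFin n)) f      ≡⟨ ∑-map suc (allFin n) f ⟩
  ∑F (f ∘ suc)                  ∎)
  where open ≡-Reasoning

∑F-const1 : ∀ n → ∑F {n} (λ _ → 1) ≡ n
∑F-const1 zero = refl
∑F-const1 (suc n) = trans (∑F-suc {n} (λ _ → 1)) (cong suc (∑F-const1 n))

∑F-δ : ∀ {n} (j : Fin n) (g : Fin n → ℕ) → ∑F (λ i → ⟦ i == j ⟧ * g i) ≡ g j
∑F-δ {suc n} zero g = begin
  ∑F (λ i → ⟦ i == zero ⟧ * g i)              ≡⟨ ∑F-suc (λ i → ⟦ i == zero ⟧ * g i) ⟩
  g zero + 0 + ∑F (λ i → ⟦ suc i == zero ⟧ * g (suc i))
    ≡⟨ cong (g zero + 0 +_) (∑-zero (allFin n) (λ i → cong (λ b → ⟦ b ⟧ * g (suc i)) (≢⇒==false {i = suc i} {zero} λ ()))) ⟩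
  g zero + 0 + 0                                ≡⟨ trans (+-identityʳ _) (+-identityʳ _) ⟩
  g zero                                        ∎
  where open ≡-Reasoning
∑F-δ {suc n} (suc j) g = begin
  ∑F (λ i → ⟦ i == suc j ⟧ * g i)             ≡⟨ ∑F-suc (λ i → ⟦ i == suc j ⟧ * g i) ⟩
  ⟦ zero == suc j ⟧ * g zero + ∑F (λ i → ⟦ suc i == suc j ⟧ * g (suc i))
    ≡⟨ cong₂ _+_ (cong (λ b → ⟦ b ⟧ * g zero) (≢⇒==false {i = zero} {suc j} λ ()))
                 (∑-cong (allFin n) (λ i → cong (λ b → ⟦ b ⟧ * g (suc i)) (==-suc i j))) ⟩
  ∑F (λ i → ⟦ i == j ⟧ * g (suc i))            ≡⟨ ∑F-δ j (g ∘ suc) ⟩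
  g (suc j)                                     ∎
  where open ≡-Reasoning

∑F-unique : ∀ {n} (q : Fin n → Bool) (j : Fin n) →
  (∀ i → q i ≡ true → i ≡ j) → q j ≡ true → ∑F (λ i → ⟦ q i ⟧) ≡ 1
∑F-unique q j unique qj = trans (∑-cong (allFin _) q≡δ) (∑F-δ j (λ _ → 1))
  where
  q≡δ : ∀ i → ⟦ q i ⟧ ≡ ⟦ i == j ⟧ * 1
  q≡δ i = trans (cong ⟦_⟧ (bool-ext (≡⇒== ∘ unique i) (λ e → subst (λ k → q k ≡ true) (sym (==⇒≡ e)) qj)))
                (sym (*-identityʳ _))

∑F-subsingleton : ∀ {n} (q : Fin n → Bool) →
  (∀ i k → q i ≡ true → q k ≡ true → i ≡ k) → ∑F (λ i → ⟦ q i ⟧) ≤ 1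
∑F-subsingleton {n} q unique with true-or-false (any q (allFin n))
... | inj₁ e = let (j , qj) = any-true⁻ q (allFin n) e in
  ≤-reflexive (∑F-unique q j (λ i qi → unique i j qi qj) qj)
... | inj₂ e = ≤-trans (≤-reflexive (any-false⇒∑≡0 q (allFin n) e)) z≤n

∑F-≢ : ∀ {n} (r : Fin n) → ∑F (λ v → ⟦ not (v == r) ⟧) ≡ n ∸ 1
∑F-≢ {n} r = begin
  ∑F (λ v → ⟦ not (v == r) ⟧)                               ≡⟨ m+n∸m≡n 1 _ ⟨
  1 + ∑F (λ v → ⟦ not (v == r) ⟧) ∸ 1
    ≡⟨ cong (λ k → k + ∑F (λ v → ⟦ not (v == r) ⟧) ∸ 1) (∑F-unique (_== r) r (λ _ → ==⇒≡) (==-refl r)) ⟨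
  ∑F (λ v → ⟦ v == r ⟧) + ∑F (λ v → ⟦ not (v == r) ⟧) ∸ 1  ≡⟨ cong (_∸ 1) (∑-+ (allFin n) _ _) ⟨
  ∑F (λ v → ⟦ v == r ⟧ + ⟦ not (v == r) ⟧) ∸ 1
    ≡⟨ cong (_∸ 1) (trans (∑-cong (allFin n) (⟦⟧+⟦not⟧ ∘ (_== r))) (∑F-const1 n)) ⟩
  n ∸ 1                                                      ∎
  where open ≡-Reasoning

∀F-true⁻ : ∀ {n} {p : Fin n → Bool} → ∀F p ≡ true → ∀ i → p i ≡ true
∀F-true⁻ {p = p} e i = all-true⁻ p e (∈-allFin i)

∀F-true : ∀ {n} {p : Fin n → Bool} → (∀ i → p i ≡ true) → ∀F p ≡ true
∀F-true {n} {p} = all-true p (allFin n)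

∃F-true⁻ : ∀ {n} {p : Fin n → Bool} → ∃F p ≡ true → ∃ λ i → p i ≡ true
∃F-true⁻ {n} {p} = any-true⁻ p (allFin n)

∃F-true : ∀ {n} {p : Fin n → Bool} (i : Fin n) → p i ≡ true → ∃F p ≡ true
∃F-true {p = p} i = any-true p (∈-allFin i)

_≟V_ : ∀ {n m} → Vec (Fin n) m → Vec (Fin n) m → Bool
[] ≟V [] = true
(x ∷ v) ≟V (y ∷ w) = (x == y) ∧ (v ≟V w)

≟V⇒≡ : ∀ {n m} {v w : Vec (Fin n) m} → v ≟V w ≡ true → v ≡ w
≟V⇒≡ {v = []} {[]} e = refl
≟V⇒≡ {v = x ∷ v} {y ∷ w} e = cong₂ _∷_ (==⇒≡ (∧-trueˡ e)) (≟V⇒≡ (∧-trueʳ (x == y) e))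

≡⇒≟V : ∀ {n m} {v w : Vec (Fin n) m} → v ≡ w → v ≟V w ≡ true
≡⇒≟V {v = []} refl = refl
≡⇒≟V {v = x ∷ v} refl = ∧-true (≡⇒== refl) (≡⇒≟V {v = v} refl)

∑V : ∀ {n} m → (Vec (Fin n) m → ℕ) → ℕ
∑V {n} m f = ∑ (allVec n m) f

∑V-suc : ∀ {n} m (f : Vec (Fin n) (suc m) → ℕ) → ∑V (suc m) f ≡ ∑F (λ x → ∑V m (λ v → f (x ∷ v)))
∑V-suc {n} m f = trans (∑-concatMap _ (allFin n) f) (∑-cong (allFin n) (λ x → ∑-map (x ∷_) (allVec n m) f))

∑V-δ : ∀ {n} m (w : Vec (Fin n) m) (g : Vec (Fin n) m → ℕ) → ∑V m (λ v → ⟦ v ≟V w ⟧ * g v) ≡ g w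
∑V-δ zero [] g = trans (+-identityʳ _) (+-identityʳ _)
∑V-δ {n} (suc m) (y ∷ w) g = begin
  ∑V (suc m) (λ v → ⟦ v ≟V (y ∷ w) ⟧ * g v)
    ≡⟨ ∑V-suc {n} m _ ⟩
  ∑F (λ x → ∑V m (λ v → ⟦ (x == y) ∧ (v ≟V w) ⟧ * g (x ∷ v)))
    ≡⟨ ∑-cong (allFin n) (λ x → ∑-cong (allVec n m) (λ v →
         trans (cong (_* g (x ∷ v)) (⟦∧⟧ (x == y) (v ≟V w))) (*-assoc ⟦ x == y ⟧ ⟦ v ≟V w ⟧ _))) ⟩
  ∑F (λ x → ∑V m (λ v → ⟦ x == y ⟧ * (⟦ v ≟V w ⟧ * g (x ∷ v))))
    ≡⟨ ∑-cong (allFin n) (λ x → trans (∑-*ˡ (allVec n m) ⟦ x == y ⟧ _)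
                                       (cong (⟦ x == y ⟧ *_) (∑V-δ m w (λ v → g (x ∷ v))))) ⟩
  ∑F (λ x → ⟦ x == y ⟧ * g (x ∷ w))
    ≡⟨ ∑F-δ y (λ x → g (x ∷ w)) ⟩
  g (y ∷ w) ∎
  where open ≡-Reasoning

∈-allVec : ∀ {n m} (v : Vec (Fin n) m) → v ∈ allVec n m
∈-allVec [] = here refl
∈-allVec {n} (x ∷ v) = ∈-concatMap⁺ (λ y → map (y ∷_) (allVec n _))
  (Any.map (λ { refl → ∈-map⁺ (x ∷_) (∈-allVec v) }) (∈-allFin x))

∑M : ∀ {n} → (Map n → ℕ) → ℕ
∑M {n} = ∑V n

countMaps≡∑M : ∀ {n} (p : Map n → Bool) → countMaps p ≡ ∑M (λ σ → ⟦ p σ ⟧)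
countMaps≡∑M {n} p = length-filterᵇ p (allMaps n)

∃Map-true⁻ : ∀ {n} {p : Map n → Bool} → ∃Map p ≡ true → ∃ λ σ → p σ ≡ true
∃Map-true⁻ {n} {p} = any-true⁻ p (allMaps n)

∃Map-true : ∀ {n} {p : Map n → Bool} (σ : Map n) → p σ ≡ true → ∃Map p ≡ true
∃Map-true {p = p} σ = any-true p (∈-allVec σ)

∑M-reindex : ∀ {n} (φ ψ : Map n → Map n) → (∀ σ → φ (ψ σ) ≡ σ) → (∀ σ → ψ (φ σ) ≡ σ) →
  (f : Map n → ℕ) → ∑M (f ∘ φ) ≡ ∑M f
∑M-reindex {n} φ ψ φψ ψφ f = begin
  ∑M (f ∘ φ)                                 ≡⟨ ∑-cong (allMaps n) (λ σ → sym (∑V-δ n (φ σ) f)) ⟩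
  ∑M (λ σ → ∑M (λ τ → ⟦ τ ≟V φ σ ⟧ * f τ))  ≡⟨ ∑-swap (allMaps n) (allMaps n) _ ⟩
  ∑M (λ τ → ∑M (λ σ → ⟦ τ ≟V φ σ ⟧ * f τ))  ≡⟨ ∑-cong (allMaps n) (λ τ → ∑-cong (allMaps n) (λ σ →
                                                 cong (λ b → ⟦ b ⟧ * f τ) (τ=φσ⇔σ=ψτ τ σ))) ⟩
  ∑M (λ τ → ∑M (λ σ → ⟦ σ ≟V ψ τ ⟧ * f τ))  ≡⟨ ∑-cong (allMaps n) (λ τ → ∑V-δ n (ψ τ) (λ _ → f τ)) ⟩
  ∑M f                                       ∎
  where
  open ≡-Reasoning
  τ=φσ⇔σ=ψτ : ∀ τ σ → (τ ≟V φ σ) ≡ (σ ≟V ψ τ)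
  τ=φσ⇔σ=ψτ τ σ = bool-ext
    (λ e → ≡⇒≟V (trans (sym (ψφ σ)) (cong ψ (sym (≟V⇒≡ e)))))
    (λ e → ≡⇒≟V (trans (sym (φψ τ)) (cong φ (sym (≟V⇒≡ e)))))

Inj : ∀ {n} → Map n → Set
Inj σ = ∀ i k → lookup σ i ≡ lookup σ k → i ≡ k

lookup-ext : ∀ {n m} {σ τ : Vec (Fin n) m} → (∀ i → lookup σ i ≡ lookup τ i) → σ ≡ τ
lookup-ext {σ = σ} {τ} f = trans (sym (tabulate∘lookup σ)) (trans (tabulate-cong f) (tabulate∘lookup τ))

_∘ᵐ_ : ∀ {n} → Map n → Map n → Map n
σ ∘ᵐ τ = tabulate (lookup σ ∘ lookup τ)

lookup-∘ᵐ : ∀ {n} (σ τ : Map n) i → lookup (σ ∘ᵐ τ) i ≡ lookup σ (lookup τ i)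
lookup-∘ᵐ σ τ = lookup∘tabulate _

inj⇒surj : ∀ {n} (σ : Map n) → Inj σ → ∀ j → ∃ λ i → lookup σ i ≡ j
inj⇒surj {suc m} σ inj j with Finₚ.any? (λ i → lookup σ i Fin.≟ j)
... | yes hit = hit
... | no miss = ⊥-elim (1+n≰n (Finₚ.injective⇒≤ {f = squeeze} squeeze-injective))
  where
  avoids : ∀ i → j ≢ lookup σ i
  avoids i e = miss (i , sym e)
  squeeze : Fin (suc m) → Fin m
  squeeze i = punchOut (avoids i)
  squeeze-injective : ∀ {i k} → squeeze i ≡ squeeze k → i ≡ k
  squeeze-injective {i} {k} e = inj i k (Finₚ.punchOut-injective (avoids i) (avoids k) e)

preimage : ∀ {n} → Map n → Fin n → Fin n
preimage σ j with Finₚ.any? (λ i → lookup σ i Fin.≟ j)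
... | yes (i , _) = i
... | no _ = j

lookup-preimage : ∀ {n} (σ : Map n) → Inj σ → ∀ j → lookup σ (preimage σ j) ≡ j
lookup-preimage σ inj j with Finₚ.any? (λ i → lookup σ i Fin.≟ j)
... | yes (i , σi≡j) = σi≡j
... | no miss = ⊥-elim (miss (inj⇒surj σ inj j))

preimage-lookup : ∀ {n} (σ : Map n) → Inj σ → ∀ i → preimage σ (lookup σ i) ≡ i
preimage-lookup σ inj i = inj _ _ (lookup-preimage σ inj (lookup σ i))

_⁻¹ᵐ : ∀ {n} → Map n → Map n
σ ⁻¹ᵐ = tabulate (preimage σ)

lookup-⁻¹ᵐ : ∀ {n} (σ : Map n) j → lookup (σ ⁻¹ᵐ) j ≡ preimage σ j
lookup-⁻¹ᵐ σ = lookup∘tabulate _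

∘ᵐ-cancelʳ : ∀ {n} (g : Map n) → Inj g → ∀ τ → (τ ∘ᵐ (g ⁻¹ᵐ)) ∘ᵐ g ≡ τ
∘ᵐ-cancelʳ g inj τ = lookup-ext λ i → begin
  lookup ((τ ∘ᵐ (g ⁻¹ᵐ)) ∘ᵐ g) i         ≡⟨ lookup-∘ᵐ (τ ∘ᵐ (g ⁻¹ᵐ)) g i ⟩
  lookup (τ ∘ᵐ (g ⁻¹ᵐ)) (lookup g i)     ≡⟨ lookup-∘ᵐ τ (g ⁻¹ᵐ) (lookup g i) ⟩
  lookup τ (lookup (g ⁻¹ᵐ) (lookup g i)) ≡⟨ cong (lookup τ) (trans (lookup-⁻¹ᵐ g _) (preimage-lookup g inj i)) ⟩
  lookup τ i                             ∎
  where open ≡-Reasoning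

⁻¹ᵐ-cancelʳ : ∀ {n} (g : Map n) → Inj g → ∀ τ → (τ ∘ᵐ g) ∘ᵐ (g ⁻¹ᵐ) ≡ τ
⁻¹ᵐ-cancelʳ g inj τ = lookup-ext λ i → begin
  lookup ((τ ∘ᵐ g) ∘ᵐ (g ⁻¹ᵐ)) i         ≡⟨ lookup-∘ᵐ (τ ∘ᵐ g) (g ⁻¹ᵐ) i ⟩
  lookup (τ ∘ᵐ g) (lookup (g ⁻¹ᵐ) i)     ≡⟨ lookup-∘ᵐ τ g (lookup (g ⁻¹ᵐ) i) ⟩
  lookup τ (lookup g (lookup (g ⁻¹ᵐ) i)) ≡⟨ cong (lookup τ ∘ lookup g) (lookup-⁻¹ᵐ g i) ⟩
  lookup τ (lookup g (preimage g i))     ≡⟨ cong (lookup τ) (lookup-preimage g inj i) ⟩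
  lookup τ i                             ∎
  where open ≡-Reasoning

record IsAut {n} (A : Fin n → Fin n → Bool) (S : Fin n → Bool) (σ : Map n) : Set where
  field
    fixes-outside : ∀ i → S i ≡ false → lookup σ i ≡ i
    maps-into : ∀ i → S i ≡ true → S (lookup σ i) ≡ true
    injective : Inj σ
    preserves : ∀ i j → S i ≡ true → S j ≡ true → A (lookup σ i) (lookup σ j) ≡ A i j

isAutOn⇒IsAut : ∀ {n} (A : Fin n → Fin n → Bool) (S : Fin n → Bool) σ → isAutOn A S σ ≡ true → IsAut A S σ
isAutOn⇒IsAut {n} A S σ e = record
  { fixes-outside = λ i si → ==⇒≡ (⇒-true⁻ (∧-trueˡ (at i)) (not-true si))
  ; maps-into = λ i → ⇒-true⁻ (∧-trueˡ (∧-trueʳ (fixes i) (at i)))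
  ; injective = λ i k eq → ==⇒≡ (⇒-true⁻ (∧-trueˡ (at₂ i k)) (≡⇒== eq))
  ; preserves = λ i j si sj → ⇔ᵇ-true⁻ (⇒-true⁻ (∧-trueʳ (injects i j) (at₂ i j)) (∧-true si sj))
  }
  where
  fixes into : Fin n → Bool
  fixes i = not (S i) ⇒ (lookup σ i == i)
  into i = S i ⇒ S (lookup σ i)
  injects preserves : Fin n → Fin n → Bool
  injects i j = (lookup σ i == lookup σ j) ⇒ (i == j)
  preserves i j = (S i ∧ S j) ⇒ (A (lookup σ i) (lookup σ j) ⇔ᵇ A i j)
  at : ∀ i → fixes i ∧ (into i ∧ ∀F (λ j → injects i j ∧ preserves i j)) ≡ true
  at = ∀F-true⁻ e
  at₂ : ∀ i j → injects i j ∧ preserves i j ≡ true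
  at₂ i = ∀F-true⁻ (∧-trueʳ (into i) (∧-trueʳ (fixes i) (at i)))

isAutROn⇒IsAut : ∀ {n} (A : Fin n → Fin n → Bool) (S : Fin n → Bool) r σ →
  isAutROn A S r σ ≡ true → IsAut A S σ × lookup σ r ≡ r
isAutROn⇒IsAut A S r σ e = isAutOn⇒IsAut A S σ (∧-trueˡ e) , ==⇒≡ (∧-trueʳ (isAutOn A S σ) e)

module _ {n} {A : Fin n → Fin n → Bool} {S : Fin n → Bool} where

  IsAut⇒isAutOn : ∀ {σ} → IsAut A S σ → isAutOn A S σ ≡ true
  IsAut⇒isAutOn a = ∀F-true λ i → ∧-true (⇒-true (≡⇒== ∘ fixes-outside i ∘ not-true⁻))
    (∧-true (⇒-true (maps-into i)) (∀F-true λ j → ∧-true (⇒-true (≡⇒== ∘ injective i j ∘ ==⇒≡))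
      (⇒-true λ sij → ⇔ᵇ-true (preserves i j (∧-trueˡ sij) (∧-trueʳ (S i) sij)))))
    where open IsAut a

  IsAut-∘ᵐ : ∀ {σ τ} → IsAut A S σ → IsAut A S τ → IsAut A S (σ ∘ᵐ τ)
  IsAut-∘ᵐ {σ} {τ} a b = record
    { fixes-outside = λ i si → trans (σ∘τ i) (trans (cong (lookup σ) (B.fixes-outside i si)) (A.fixes-outside i si))
    ; maps-into = λ i si → subst (λ k → S k ≡ true) (sym (σ∘τ i)) (A.maps-into _ (B.maps-into i si))
    ; injective = λ i k e → B.injective i k (A.injective _ _ (trans (sym (σ∘τ i)) (trans e (σ∘τ k))))
    ; preserves = λ i j si sj → trans (cong₂ A (σ∘τ i) (σ∘τ j))
        (trans (A.preserves _ _ (B.maps-into i si) (B.maps-into j sj)) (B.preserves i j si sj))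
    }
    where
    module A = IsAut a
    module B = IsAut b
    σ∘τ : ∀ i → lookup (σ ∘ᵐ τ) i ≡ lookup σ (lookup τ i)
    σ∘τ = lookup-∘ᵐ σ τ

  IsAut-⁻¹ᵐ : ∀ {σ} → IsAut A S σ → IsAut A S (σ ⁻¹ᵐ)
  IsAut-⁻¹ᵐ {σ} a = record
    { fixes-outside = σ⁻¹-fixes-outside
    ; maps-into = σ⁻¹-maps-into
    ; injective = λ i k e → trans (sym (σσ⁻¹ i)) (trans (cong (lookup σ) e) (σσ⁻¹ k))
    ; preserves = λ i j si sj → trans
        (sym (preserves (lookup (σ ⁻¹ᵐ) i) (lookup (σ ⁻¹ᵐ) j) (σ⁻¹-maps-into i si) (σ⁻¹-maps-into j sj)))
        (cong₂ A (σσ⁻¹ i) (σσ⁻¹ j))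
    }
    where
    open IsAut a
    σσ⁻¹ : ∀ i → lookup σ (lookup (σ ⁻¹ᵐ) i) ≡ i
    σσ⁻¹ i = trans (cong (lookup σ) (lookup-⁻¹ᵐ σ i)) (lookup-preimage σ injective i)
    σ⁻¹-fixes-outside : ∀ i → S i ≡ false → lookup (σ ⁻¹ᵐ) i ≡ i
    σ⁻¹-fixes-outside i si = injective _ _ (trans (σσ⁻¹ i) (sym (fixes-outside i si)))
    σ⁻¹-maps-into : ∀ i → S i ≡ true → S (lookup (σ ⁻¹ᵐ) i) ≡ true
    σ⁻¹-maps-into i si with true-or-false (S (lookup (σ ⁻¹ᵐ) i))
    ... | inj₁ s = s
    ... | inj₂ s = contradictionᵇ si (subst (λ k → S k ≡ false) (trans (sym (fixes-outside _ s)) (σσ⁻¹ i)) s)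

  IsAut⇒isAutROn : ∀ {r σ} → IsAut A S σ → lookup σ r ≡ r → isAutROn A S r σ ≡ true
  IsAut⇒isAutROn a σr = ∧-true (IsAut⇒isAutOn a) (≡⇒== σr)

-- Orbit–stabilizer

record IsMapGroup {n} (G : Map n → Bool) : Set where
  field
    injective : ∀ σ → G σ ≡ true → Inj σ
    ∘ᵐ-closed : ∀ σ τ → G σ ≡ true → G τ ≡ true → G (σ ∘ᵐ τ) ≡ true
    ⁻¹ᵐ-closed : ∀ σ → G σ ≡ true → G (σ ⁻¹ᵐ) ≡ true

-- Count the pairs (σ , x) with σ ∈ G and hits σ x in two ways.
double-count : ∀ {n} {X : Set} (G : Map n → Bool) (xs : List X) (hits : Map n → X → Bool)
  (orbit : X → Bool) (s : ℕ) →
  (∀ σ → G σ ≡ true → ∑ xs (λ x → ⟦ hits σ x ⟧) ≡ 1) →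
  (∀ x → ∑M (λ σ → ⟦ G σ ∧ hits σ x ⟧) ≡ ⟦ orbit x ⟧ * s) →
  ∑ xs (λ x → ⟦ orbit x ⟧) * s ≡ ∑M (λ σ → ⟦ G σ ⟧)
double-count {n} G xs hits orbit s hits-once fibre = begin
  ∑ xs (λ x → ⟦ orbit x ⟧) * s                     ≡⟨ ∑-*ʳ xs s (λ x → ⟦ orbit x ⟧) ⟨
  ∑ xs (λ x → ⟦ orbit x ⟧ * s)                     ≡⟨ ∑-cong xs (λ x → sym (fibre x)) ⟩
  ∑ xs (λ x → ∑M (λ σ → ⟦ G σ ∧ hits σ x ⟧))      ≡⟨ ∑-swap xs (allMaps n) _ ⟩
  ∑M (λ σ → ∑ xs (λ x → ⟦ G σ ∧ hits σ x ⟧))      ≡⟨ ∑-cong (allMaps n) (λ σ →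
                                                       trans (∑-cong xs (λ x → ⟦∧⟧ (G σ) (hits σ x)))
                                                             (∑-*ˡ xs ⟦ G σ ⟧ _)) ⟩
  ∑M (λ σ → ⟦ G σ ⟧ * ∑ xs (λ x → ⟦ hits σ x ⟧))  ≡⟨ ∑-cong (allMaps n) counted-once ⟩
  ∑M (λ σ → ⟦ G σ ⟧)                               ∎
  where
  open ≡-Reasoning
  counted-once : ∀ σ → ⟦ G σ ⟧ * ∑ xs (λ x → ⟦ hits σ x ⟧) ≡ ⟦ G σ ⟧
  counted-once σ with true-or-false (G σ)
  ... | inj₁ σ∈G = trans (cong (⟦ G σ ⟧ *_) (hits-once σ σ∈G)) (*-identityʳ _)
  ... | inj₂ σ∉G rewrite σ∉G = refl

module _ {n} {G : Map n → Bool} (isGroup : IsMapGroup G) where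
  open IsMapGroup isGroup

  ∘ᵐ-closed-iff : ∀ g τ → G g ≡ true → G (τ ∘ᵐ g) ≡ G τ
  ∘ᵐ-closed-iff g τ g∈G = bool-ext
    (λ τg∈G → subst (λ ρ → G ρ ≡ true) (⁻¹ᵐ-cancelʳ g (injective g g∈G) τ)
                    (∘ᵐ-closed _ _ τg∈G (⁻¹ᵐ-closed g g∈G)))
    (λ τ∈G → ∘ᵐ-closed τ g τ∈G g∈G)

  ∑M-translate : (f f₀ : Map n → Bool) (g : Map n) → G g ≡ true → (∀ τ → f (τ ∘ᵐ g) ≡ f₀ τ) →
    ∑M (λ σ → ⟦ G σ ∧ f σ ⟧) ≡ ∑M (λ τ → ⟦ G τ ∧ f₀ τ ⟧)
  ∑M-translate f f₀ g g∈G f∘g = trans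
    (sym (∑M-reindex (_∘ᵐ g) (_∘ᵐ (g ⁻¹ᵐ)) (∘ᵐ-cancelʳ g inj) (⁻¹ᵐ-cancelʳ g inj) (λ σ → ⟦ G σ ∧ f σ ⟧)))
    (∑-cong (allMaps n) (λ τ → cong₂ (λ x y → ⟦ x ∧ y ⟧) (∘ᵐ-closed-iff g τ g∈G) (f∘g τ)))
    where inj = injective g g∈G

  stabilizer : Fin n → Map n → Bool
  stabilizer v τ = G τ ∧ (lookup τ v == v)

  vertex-orbit-stabilizer : (S : Fin n → Bool) → (∀ σ w → G σ ≡ true → S w ≡ false → lookup σ w ≡ w) →
    (v : Fin n) → S v ≡ true →
    countF (λ w → S w ∧ ∃Map (λ σ → G σ ∧ (lookup σ w == v))) * ∑M (λ τ → ⟦ stabilizer v τ ⟧)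
      ≡ ∑M (λ σ → ⟦ G σ ⟧)
  vertex-orbit-stabilizer S fixes-outside v v∈S =
    trans (cong (_* ∑M (λ τ → ⟦ stabilizer v τ ⟧)) (countF≡∑F orbit))
          (double-count G (allFin n) hits orbit _ hits-once fibre)
    where
    hits : Map n → Fin n → Bool
    hits σ w = lookup σ w == v
    orbit : Fin n → Bool
    orbit w = S w ∧ ∃Map (λ σ → G σ ∧ hits σ w)
    hits-once : ∀ σ → G σ ≡ true → ∑F (λ w → ⟦ hits σ w ⟧) ≡ 1
    hits-once σ σ∈G = ∑F-unique (hits σ) (preimage σ v)
      (λ w e → trans (sym (preimage-lookup σ (injective σ σ∈G) w)) (cong (preimage σ) (==⇒≡ e)))
      (≡⇒== (lookup-preimage σ (injective σ σ∈G) v))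
    empty-fibre : ∀ w → S w ≡ false → ∀ σ → G σ ∧ hits σ w ≡ false
    empty-fibre w w∉S σ = ≢true⇒false λ e → contradictionᵇ v∈S
      (subst (λ k → S k ≡ false) (trans (sym (fixes-outside σ w (∧-trueˡ e) w∉S)) (==⇒≡ (∧-trueʳ (G σ) e))) w∉S)
    fibre : ∀ w → ∑M (λ σ → ⟦ G σ ∧ hits σ w ⟧) ≡ ⟦ orbit w ⟧ * ∑M (λ τ → ⟦ stabilizer v τ ⟧)
    fibre w with true-or-false (S w) | true-or-false (∃Map (λ σ → G σ ∧ hits σ w))
    ... | inj₂ w∉S | _ rewrite w∉S = ∑-zero (allMaps n) (λ σ → cong ⟦_⟧ (empty-fibre w w∉S σ))
    ... | inj₁ w∈S | inj₂ hit⇒orbit rewrite w∈S | hit⇒orbit = any-false⇒∑≡0 _ (allMaps n) hit⇒orbit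
    ... | inj₁ w∈S | inj₁ hit rewrite w∈S | hit =
      let (g , g∈G∧gw=v) = ∃Map-true⁻ hit in
      trans (∑M-translate (λ σ → hits σ w) (λ τ → lookup τ v == v) g (∧-trueˡ g∈G∧gw=v)
              (λ τ → cong (_== v) (trans (lookup-∘ᵐ τ g w) (cong (lookup τ) (==⇒≡ (∧-trueʳ (G g) g∈G∧gw=v))))))
            (sym (+-identityʳ _))

module _ {n} (A : Fin n → Fin n → Bool) (S : Fin n → Bool) where
  private
    aut : ∀ σ → isAutOn A S σ ≡ true → IsAut A S σ
    aut = isAutOn⇒IsAut A S
    autR : ∀ {r} σ → isAutROn A S r σ ≡ true → IsAut A S σ × lookup σ r ≡ r
    autR {r} = isAutROn⇒IsAut A S r

  aut-isMapGroup : IsMapGroup (isAutOn A S)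
  aut-isMapGroup = record
    { injective = λ σ → IsAut.injective ∘ aut σ
    ; ∘ᵐ-closed = λ σ τ σ∈ τ∈ → IsAut⇒isAutOn (IsAut-∘ᵐ (aut σ σ∈) (aut τ τ∈))
    ; ⁻¹ᵐ-closed = λ σ σ∈ → IsAut⇒isAutOn (IsAut-⁻¹ᵐ (aut σ σ∈))
    }

  autR-isMapGroup : (r : Fin n) → IsMapGroup (isAutROn A S r)
  autR-isMapGroup r = record
    { injective = λ σ σ∈ → IsAut.injective (proj₁ (autR σ σ∈))
    ; ∘ᵐ-closed = λ σ τ σ∈ τ∈ →
        let (σ-aut , σr) = autR σ σ∈ ; (τ-aut , τr) = autR τ τ∈ in
        IsAut⇒isAutROn (IsAut-∘ᵐ σ-aut τ-aut) (trans (lookup-∘ᵐ σ τ r) (trans (cong (lookup σ) τr) σr))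
    ; ⁻¹ᵐ-closed = λ σ σ∈ →
        let (σ-aut , σr) = autR σ σ∈ in
        IsAut⇒isAutROn (IsAut-⁻¹ᵐ σ-aut)
          (trans (lookup-⁻¹ᵐ σ r) (trans (cong (preimage σ) (sym σr)) (preimage-lookup σ (IsAut.injective σ-aut) r)))
    }

SameEdge : ∀ {n} → Fin n → Fin n → Fin n → Fin n → Set
SameEdge i j a b = (i ≡ a × j ≡ b) ⊎ (i ≡ b × j ≡ a)

sameEdge⇒SameEdge : ∀ {n} (i j a b : Fin n) → sameEdge i j a b ≡ true → SameEdge i j a b
sameEdge⇒SameEdge i j a b e with ∨-true⁻ ((i == a) ∧ (j == b)) e
... | inj₁ p = inj₁ (==⇒≡ (∧-trueˡ p) , ==⇒≡ (∧-trueʳ (i == a) p))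
... | inj₂ p = inj₂ (==⇒≡ (∧-trueˡ p) , ==⇒≡ (∧-trueʳ (i == b) p))

SameEdge⇒sameEdge : ∀ {n} (i j a b : Fin n) → SameEdge i j a b → sameEdge i j a b ≡ true
SameEdge⇒sameEdge _ _ a b (inj₁ (refl , refl)) = ∨-trueˡ ((a == b) ∧ (b == a)) (∧-true (==-refl a) (==-refl b))
SameEdge⇒sameEdge _ _ a b (inj₂ (refl , refl)) = ∨-trueʳ ((b == a) ∧ (a == b)) (∧-true (==-refl b) (==-refl a))

sameEdge-refl : ∀ {n} (a b : Fin n) → sameEdge a b a b ≡ true
sameEdge-refl a b = SameEdge⇒sameEdge a b a b (inj₁ (refl , refl))

SameEdge-swap : ∀ {n} {i j a b : Fin n} → SameEdge i j a b → SameEdge j i a b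
SameEdge-swap (inj₁ (p , q)) = inj₂ (q , p)
SameEdge-swap (inj₂ (p , q)) = inj₁ (q , p)

SameEdge-swapʳ : ∀ {n} {i j a b : Fin n} → SameEdge i j a b → SameEdge i j b a
SameEdge-swapʳ (inj₁ p) = inj₂ p
SameEdge-swapʳ (inj₂ p) = inj₁ p

sameEdge-swap : ∀ {n} (i j a b : Fin n) → sameEdge i j a b ≡ sameEdge j i a b
sameEdge-swap i j a b = bool-ext
  (SameEdge⇒sameEdge j i a b ∘ SameEdge-swap ∘ sameEdge⇒SameEdge i j a b)
  (SameEdge⇒sameEdge i j a b ∘ SameEdge-swap ∘ sameEdge⇒SameEdge j i a b)

sameEdge-swapʳ : ∀ {n} (i j a b : Fin n) → sameEdge i j a b ≡ sameEdge i j b a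
sameEdge-swapʳ i j a b = bool-ext
  (SameEdge⇒sameEdge i j b a ∘ SameEdge-swapʳ ∘ sameEdge⇒SameEdge i j a b)
  (SameEdge⇒sameEdge i j a b ∘ SameEdge-swapʳ ∘ sameEdge⇒SameEdge i j b a)

SameEdge-trans : ∀ {n} {i j a b c d : Fin n} → SameEdge i j a b → SameEdge a b c d → SameEdge i j c d
SameEdge-trans (inj₁ (refl , refl)) q = q
SameEdge-trans (inj₂ (refl , refl)) q = SameEdge-swap q

pairs : ∀ n → List (Fin n × Fin n)
pairs n = concatMap (λ i → map (i ,_) (allFin n)) (allFin n)

∑-pairs : ∀ {n} (f : Fin n × Fin n → ℕ) → ∑ (pairs n) f ≡ ∑F (λ c → ∑F (λ d → f (c , d)))
∑-pairs {n} f = trans (∑-concatMap _ (allFin n) f) (∑-cong (allFin n) (λ c → ∑-map (c ,_) (allFin n) f))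

countPairs≡∑F∑F : ∀ {n} (p : Fin n → Fin n → Bool) → countPairs p ≡ ∑F (λ c → ∑F (λ d → ⟦ p c d ⟧))
countPairs≡∑F∑F {n} p = trans (length-filterᵇ _ (pairs n)) (∑-pairs (λ cd → ⟦ p (proj₁ cd) (proj₂ cd) ⟧))

∑F∑F-unique : ∀ {n} (q : Fin n → Fin n → Bool) (c₀ d₀ : Fin n) →
  (∀ c d → q c d ≡ true → c ≡ c₀ × d ≡ d₀) → q c₀ d₀ ≡ true → ∑F (λ c → ∑F (λ d → ⟦ q c d ⟧)) ≡ 1
∑F∑F-unique {n} q c₀ d₀ unique q₀ = trans (∑-cong (allFin n) row) (∑F-δ c₀ (λ _ → 1))
  where
  row : ∀ c → ∑F (λ d → ⟦ q c d ⟧) ≡ ⟦ c == c₀ ⟧ * 1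
  row c with true-or-false (c == c₀)
  ... | inj₁ e rewrite e | ==⇒≡ e = ∑F-unique (q c₀) d₀ (λ d qd → proj₂ (unique c₀ d qd)) q₀
  ... | inj₂ e rewrite e = ∑-zero (allFin n) (λ d → cong ⟦_⟧ (≢true⇒false λ qd →
                             contradictionᵇ (≡⇒== (proj₁ (unique c d qd))) e))

∑-ordered-SameEdge≡1 : ∀ {n} (x y : Fin n) → x ≢ y →
  ∑F (λ c → ∑F (λ d → ⟦ (c <F d) ∧ sameEdge c d x y ⟧)) ≡ 1
∑-ordered-SameEdge≡1 x y x≢y with <F-connex x≢y
... | inj₁ x<y = ∑F∑F-unique _ x y ordered (∧-true x<y (sameEdge-refl x y))
  where
  ordered : ∀ c d → (c <F d) ∧ sameEdge c d x y ≡ true → c ≡ x × d ≡ y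
  ordered c d e with sameEdge⇒SameEdge c d x y (∧-trueʳ (c <F d) e)
  ... | inj₁ p = p
  ... | inj₂ (refl , refl) = ⊥-elim (<F-asym x<y (∧-trueˡ e))
... | inj₂ y<x = ∑F∑F-unique _ y x ordered (∧-true y<x (SameEdge⇒sameEdge y x x y (inj₂ (refl , refl))))
  where
  ordered : ∀ c d → (c <F d) ∧ sameEdge c d x y ≡ true → c ≡ y × d ≡ x
  ordered c d e with sameEdge⇒SameEdge c d x y (∧-trueʳ (c <F d) e)
  ... | inj₂ p = p
  ... | inj₁ (refl , refl) = ⊥-elim (<F-asym y<x (∧-trueˡ e))

sameEdge-preimage : ∀ {n} (σ : Map n) → Inj σ → ∀ c d a b →
  sameEdge (lookup σ c) (lookup σ d) a b ≡ sameEdge c d (preimage σ a) (preimage σ b)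
sameEdge-preimage σ inj c d a b = bool-ext
  (SameEdge⇒sameEdge _ _ _ _ ∘ forward ∘ sameEdge⇒SameEdge _ _ a b)
  (SameEdge⇒sameEdge _ _ a b ∘ backward ∘ sameEdge⇒SameEdge c d _ _)
  where
  σ⁻¹σ : ∀ i → preimage σ (lookup σ i) ≡ i
  σ⁻¹σ = preimage-lookup σ inj
  σσ⁻¹ : ∀ j → lookup σ (preimage σ j) ≡ j
  σσ⁻¹ = lookup-preimage σ inj
  forward : ∀ {a b} → SameEdge (lookup σ c) (lookup σ d) a b → SameEdge c d (preimage σ a) (preimage σ b)
  forward (inj₁ (refl , refl)) = inj₁ (sym (σ⁻¹σ c) , sym (σ⁻¹σ d))
  forward (inj₂ (refl , refl)) = inj₂ (sym (σ⁻¹σ c) , sym (σ⁻¹σ d))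
  backward : ∀ {c d} → SameEdge c d (preimage σ a) (preimage σ b) → SameEdge (lookup σ c) (lookup σ d) a b
  backward (inj₁ (refl , refl)) = inj₁ (σσ⁻¹ a , σσ⁻¹ b)
  backward (inj₂ (refl , refl)) = inj₂ (σσ⁻¹ b , σσ⁻¹ a)

sameEdge-image : ∀ {n} (f : Fin n → Fin n) {x y a b} → SameEdge x y a b →
  ∀ c d → sameEdge (f x) (f y) c d ≡ sameEdge (f a) (f b) c d
sameEdge-image f (inj₁ (refl , refl)) c d = refl
sameEdge-image f (inj₂ (refl , refl)) c d = sameEdge-swap (f _) (f _) c d

edgeStabilizer : ∀ {n} → Graph n → Fin n → Fin n → Fin n → Map n → Bool
edgeStabilizer G r a b σ = isAutROn (adj G) full r σ ∧ sameEdge (lookup σ a) (lookup σ b) a b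

adj⇒≢ : ∀ {n} (G : Graph n) {a b : Fin n} → adj G a b ≡ true → a ≢ b
adj⇒≢ G {a} ab refl = contradictionᵇ ab (irrefl G a)

SameEdge⇒adj : ∀ {n} (G : Graph n) {a b x y : Fin n} → adj G a b ≡ true → SameEdge x y a b → adj G x y ≡ true
SameEdge⇒adj G ab (inj₁ (refl , refl)) = ab
SameEdge⇒adj G {a} {b} ab (inj₂ (refl , refl)) = trans (Graph.sym G b a) ab

module _ {n} (G : Graph n) (r : Fin n) {a b : Fin n} (ab : adj G a b ≡ true) where
  private
    H : Map n → Bool
    H = isAutROn (adj G) full r
    open IsMapGroup (autR-isMapGroup (adj G) full r)

  edge-orbit-stabilizer : mEdge G r a b * ∑M (λ τ → ⟦ edgeStabilizer G r a b τ ⟧) ≡ AutR (adj G) full r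
  edge-orbit-stabilizer = begin
    mEdge G r a b * s                     ≡⟨ cong (_* s) (length-filterᵇ _ (pairs n)) ⟩
    ∑ (pairs n) (λ cd → ⟦ orbit cd ⟧) * s ≡⟨ double-count H (pairs n) hits orbit s hits-once fibre ⟩
    ∑M (λ σ → ⟦ H σ ⟧)                    ≡⟨ countMaps≡∑M H ⟨
    AutR (adj G) full r                   ∎
    where
    open ≡-Reasoning
    s : ℕ
    s = ∑M (λ τ → ⟦ edgeStabilizer G r a b τ ⟧)
    mapsTo : Map n → Fin n → Fin n → Bool
    mapsTo σ c d = sameEdge (lookup σ c) (lookup σ d) a b
    hits : Map n → Fin n × Fin n → Bool
    hits σ (c , d) = (c <F d) ∧ mapsTo σ c d
    orbit : Fin n × Fin n → Bool
    orbit (c , d) = (c <F d) ∧ adj G c d ∧ ∃Map (λ σ → H σ ∧ mapsTo σ c d)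

    hits-once : ∀ σ → H σ ≡ true → ∑ (pairs n) (λ cd → ⟦ hits σ cd ⟧) ≡ 1
    hits-once σ σ∈H = begin
      ∑ (pairs n) (λ cd → ⟦ hits σ cd ⟧)
        ≡⟨ ∑-pairs (λ cd → ⟦ hits σ cd ⟧) ⟩
      ∑F (λ c → ∑F (λ d → ⟦ (c <F d) ∧ mapsTo σ c d ⟧))
        ≡⟨ ∑-cong (allFin n) (λ c → ∑-cong (allFin n) (λ d →
             cong (λ e → ⟦ (c <F d) ∧ e ⟧) (sameEdge-preimage σ σ-inj c d a b))) ⟩
      ∑F (λ c → ∑F (λ d → ⟦ (c <F d) ∧ sameEdge c d (preimage σ a) (preimage σ b) ⟧))
        ≡⟨ ∑-ordered-SameEdge≡1 _ _ (adj⇒≢ G ab ∘ preimage-injective) ⟩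
      1 ∎
      where
      σ-inj : Inj σ
      σ-inj = injective σ σ∈H
      preimage-injective : preimage σ a ≡ preimage σ b → a ≡ b
      preimage-injective e = trans (sym (lookup-preimage σ σ-inj a))
                                   (trans (cong (lookup σ) e) (lookup-preimage σ σ-inj b))

    hit⇒orbit : ∀ c d σ → H σ ∧ hits σ (c , d) ≡ true → orbit (c , d) ≡ true
    hit⇒orbit c d σ e = ∧-true c<d (∧-true cd-adj (∃Map-true {p = λ τ → H τ ∧ mapsTo τ c d} σ (∧-true σ∈H σcd)))
      where
      σ∈H : H σ ≡ true
      σ∈H = ∧-trueˡ e
      c<d : c <F d ≡ true
      c<d = ∧-trueˡ (∧-trueʳ (H σ) e)
      σcd : mapsTo σ c d ≡ true
      σcd = ∧-trueʳ (c <F d) (∧-trueʳ (H σ) e)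
      cd-adj : adj G c d ≡ true
      cd-adj = trans (sym (IsAut.preserves (proj₁ (isAutROn⇒IsAut (adj G) full r σ σ∈H)) c d refl refl))
                     (SameEdge⇒adj G ab (sameEdge⇒SameEdge _ _ a b σcd))

    fibre : ∀ cd → ∑M (λ σ → ⟦ H σ ∧ hits σ cd ⟧) ≡ ⟦ orbit cd ⟧ * s
    fibre (c , d) with true-or-false (orbit (c , d))
    ... | inj₂ out rewrite out = any-false⇒∑≡0 _ (allMaps n) (≢true⇒false λ e →
          let (σ , σ-hits) = ∃Map-true⁻ e in contradictionᵇ (hit⇒orbit c d σ σ-hits) out)
    ... | inj₁ in-orbit rewrite in-orbit =
      let c<d = ∧-trueˡ in-orbit
          (g , g-maps) = ∃Map-true⁻ (∧-trueʳ (adj G c d) (∧-trueʳ (c <F d) in-orbit))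
          gcd≐ab = sameEdge⇒SameEdge _ _ a b (∧-trueʳ (H g) g-maps)
      in trans (∑M-translate (autR-isMapGroup (adj G) full r) (λ σ → hits σ (c , d)) (λ τ → mapsTo τ a b) g (∧-trueˡ g-maps)
                  (λ τ → trans (∧-trueˡ-identity _ c<d)
                    (trans (cong₂ (λ x y → sameEdge x y a b) (lookup-∘ᵐ τ g c) (lookup-∘ᵐ τ g d))
                           (sameEdge-image (lookup τ) gcd≐ab a b))))
               (sym (+-identityʳ _))

module Reach {n} (Ad : Fin n → Fin n → Bool) where

  reach-suc : ∀ k u v → reach k Ad u v ≡ true → reach (suc k) Ad u v ≡ true
  reach-suc k u v = ∨-trueˡ _

  reach-mono : ∀ {k m} u v → k ≤ m → reach k Ad u v ≡ true → reach m Ad u v ≡ true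
  reach-mono {k} {m} u v k≤m e with m≤n⇒m<n∨m≡n k≤m
  ... | inj₂ refl = e
  reach-mono {k} {suc m} u v _ e | inj₁ (s≤s k≤m) = reach-suc m u v (reach-mono u v k≤m e)

  reach-refl : ∀ k u → reach k Ad u u ≡ true
  reach-refl k u = reach-mono {0} {k} u u z≤n (==-refl u)

  reach-step : ∀ k u w v → reach k Ad u w ≡ true → Ad w v ≡ true → reach (suc k) Ad u v ≡ true
  reach-step k u w v uw wv =
    ∨-trueʳ (reach k Ad u v) (∃F-true {p = λ x → reach k Ad u x ∧ Ad x v} w (∧-true uw wv))

  reach-suc⁻ : ∀ k u v → reach (suc k) Ad u v ≡ true →
    (reach k Ad u v ≡ true) ⊎ (∃ λ w → reach k Ad u w ≡ true × Ad w v ≡ true)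
  reach-suc⁻ k u v e with ∨-true⁻ (reach k Ad u v) e
  ... | inj₁ uv = inj₁ uv
  ... | inj₂ last = let (w , uw∧wv) = ∃F-true⁻ {p = λ x → reach k Ad u x ∧ Ad x v} last in
    inj₂ (w , ∧-trueˡ uw∧wv , ∧-trueʳ (reach k Ad u w) uw∧wv)

  AtDistance : Fin n → ℕ → Fin n → Set
  AtDistance u k v = reach k Ad u v ≡ true × (∀ j → j < k → reach j Ad u v ≡ false)

  AtDistance-unique : ∀ u i j v → AtDistance u i v → AtDistance u j v → i ≡ j
  AtDistance-unique u i j v (ri , mi) (rj , mj) with <-cmp i j
  ... | tri< i<j _ _ = contradictionᵇ ri (mj i i<j)
  ... | tri≈ _ i≡j _ = i≡j
  ... | tri> _ _ j<i = contradictionᵇ rj (mi j j<i)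

  Layers : Fin n → ℕ → Set
  Layers u k = Σ (ℕ → Fin n) λ layer → ∀ i → i ≤ k → AtDistance u i (layer i)

  shortest-path : ∀ u k v → AtDistance u k v → Layers u k
  shortest-path u zero v at = (λ _ → v) , λ { zero z≤n → at }
  shortest-path u (suc k) v at@(uv , shorter) with reach-suc⁻ k u v uv
  ... | inj₁ earlier = contradictionᵇ earlier (shorter k ≤-refl)
  ... | inj₂ (w , uw , wv) = extend , extend-at
    where
    w-at : AtDistance u k w
    w-at = uw , λ j j<k → ≢true⇒false λ uw′ → contradictionᵇ (reach-step j u w v uw′ wv) (shorter (suc j) (s≤s j<k))
    prefix : Layers u k
    prefix = shortest-path u k w w-at
    extend : ℕ → Fin n
    extend i with i ≤? k
    ... | yes _ = proj₁ prefix i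
    ... | no _ = v
    extend-at : ∀ i → i ≤ suc k → AtDistance u i (extend i)
    extend-at i i≤ with i ≤? k
    ... | yes i≤k = proj₂ prefix i i≤k
    ... | no i≰k with m≤n⇒m<n∨m≡n i≤
    ...   | inj₁ (s≤s i≤k) = ⊥-elim (i≰k i≤k)
    ...   | inj₂ refl = at

  -- A vertex at distance n + 1 would give n + 2 vertices at distinct distances.
  reach-saturates : ∀ u v → reach (suc n) Ad u v ≡ true → reach n Ad u v ≡ true
  reach-saturates u v e with true-or-false (reach n Ad u v)
  ... | inj₁ uv = uv
  ... | inj₂ ¬uv = ⊥-elim (1+n≰n (≤-trans (n≤1+n (suc n)) (Finₚ.injective⇒≤ {f = vertexAt} vertexAt-injective)))
    where
    at : AtDistance u (suc n) v
    at = e , λ j j<sn → ≢true⇒false λ uv → contradictionᵇ (reach-mono u v (≤-pred j<sn) uv) ¬uv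
    layers : Layers u (suc n)
    layers = shortest-path u (suc n) v at
    vertexAt : Fin (suc (suc n)) → Fin n
    vertexAt i = proj₁ layers (toℕ i)
    vertexAt-at : ∀ i → AtDistance u (toℕ i) (vertexAt i)
    vertexAt-at i = proj₂ layers (toℕ i) (≤-pred (Finₚ.toℕ<n i))
    vertexAt-injective : ∀ {i k} → vertexAt i ≡ vertexAt k → i ≡ k
    vertexAt-injective {i} {k} e = Finₚ.toℕ-injective
      (AtDistance-unique u (toℕ i) (toℕ k) (vertexAt k) (subst (AtDistance u (toℕ i)) e (vertexAt-at i)) (vertexAt-at k))

  reachable-step : ∀ u i j → reachable Ad u i ≡ true → Ad i j ≡ true → reachable Ad u j ≡ true
  reachable-step u i j ui ij = reach-saturates u j (reach-step n u i j ui ij)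

  reach-image : (σ : Map n) → (∀ x y → Ad (lookup σ x) (lookup σ y) ≡ Ad x y) →
    ∀ k u v → reach k Ad u v ≡ true → reach k Ad (lookup σ u) (lookup σ v) ≡ true
  reach-image σ σ-pres zero u v e = ≡⇒== (cong (lookup σ) (==⇒≡ e))
  reach-image σ σ-pres (suc k) u v e with reach-suc⁻ k u v e
  ... | inj₁ uv = reach-suc k _ _ (reach-image σ σ-pres k u v uv)
  ... | inj₂ (w , uw , wv) = reach-step k _ (lookup σ w) _ (reach-image σ σ-pres k u w uw) (trans (σ-pres w v) wv)

  reach-closed : (X : Fin n → Bool) (u : Fin n) → X u ≡ true →
    (∀ i j → X i ≡ true → Ad i j ≡ true → X j ≡ true) → ∀ k v → reach k Ad u v ≡ true → X v ≡ true
  reach-closed X u u∈X closed zero v e = subst (λ x → X x ≡ true) (==⇒≡ e) u∈X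
  reach-closed X u u∈X closed (suc k) v e with reach-suc⁻ k u v e
  ... | inj₁ uv = reach-closed X u u∈X closed k v uv
  ... | inj₂ (w , uw , wv) = closed w v (reach-closed X u u∈X closed k w uw) wv

-- A connected graph on n vertices has at least n ∸ 1 edges

least : (ℕ → Bool) → ℕ → ℕ
least P zero = zero
least P (suc k) with P zero
... | true = zero
... | false = suc (least (P ∘ suc) k)

least-holds : ∀ (P : ℕ → Bool) k → P k ≡ true → P (least P k) ≡ true
least-holds P zero e = e
least-holds P (suc k) e with P zero in P0
... | true = P0
... | false = least-holds (P ∘ suc) k e

least-minimal : ∀ (P : ℕ → Bool) k j → P j ≡ true → least P k ≤ j
least-minimal P zero j e = z≤n
least-minimal P (suc k) j e with P zero in P0
... | true = z≤n
least-minimal P (suc k) zero e | false = contradictionᵇ e P0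
least-minimal P (suc k) (suc j) e | false = s≤s (least-minimal (P ∘ suc) k j e)

-- Sending each non-root vertex v to the edge {v , parent v}, with the parent one step closer
-- to r, is injective.
module ConnectedEdgeBound {n} (Ad : Fin n → Fin n → Bool) (Ad-sym : ∀ x y → Ad x y ≡ Ad y x)
  (Ad-irrefl : ∀ x → Ad x x ≡ false) (r : Fin n) (connected : ∀ v → reachable Ad r v ≡ true) where
  open Reach Ad

  dist : Fin n → ℕ
  dist v = least (λ k → reach k Ad r v) n

  dist-reach : ∀ v → reach (dist v) Ad r v ≡ true
  dist-reach v = least-holds (λ k → reach k Ad r v) n (connected v)

  dist-minimal : ∀ v j → reach j Ad r v ≡ true → dist v ≤ j
  dist-minimal v = least-minimal (λ k → reach k Ad r v) n

  dist-suc : ∀ v → v ≢ r → ∃ λ k → dist v ≡ suc k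
  dist-suc v v≢r with dist v in dv
  ... | suc k = k , refl
  ... | zero = ⊥-elim (v≢r (sym (==⇒≡ (subst (λ k → reach k Ad r v ≡ true) dv (dist-reach v)))))

  closerNeighbour : Fin n → Fin n → Bool
  closerNeighbour v w = reach (pred (dist v)) Ad r w ∧ Ad w v

  parent : Fin n → Fin n
  parent v with Finₚ.any? (λ w → closerNeighbour v w ≟ᵇ true)
  ... | yes (w , _) = w
  ... | no _ = v

  closerNeighbour-exists : ∀ v → v ≢ r → ∃ λ w → closerNeighbour v w ≡ true
  closerNeighbour-exists v v≢r with dist-suc v v≢r
  ... | k , dv with reach-suc⁻ k r v (subst (λ j → reach j Ad r v ≡ true) dv (dist-reach v))
  ...   | inj₁ earlier = ⊥-elim (1+n≰n (≤-trans (≤-reflexive (sym dv)) (dist-minimal v k earlier)))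
  ...   | inj₂ (w , rw , wv) = w , ∧-true (subst (λ j → reach (pred j) Ad r w ≡ true) (sym dv) rw) wv

  parent-closer : ∀ v → v ≢ r → closerNeighbour v (parent v) ≡ true
  parent-closer v v≢r with Finₚ.any? (λ w → closerNeighbour v w ≟ᵇ true)
  ... | yes (w , cw) = cw
  ... | no none = ⊥-elim (none (closerNeighbour-exists v v≢r))

  parent-adj : ∀ v → v ≢ r → Ad (parent v) v ≡ true
  parent-adj v v≢r = ∧-trueʳ (reach (pred (dist v)) Ad r (parent v)) (parent-closer v v≢r)

  dist-parent : ∀ v → v ≢ r → dist (parent v) < dist v
  dist-parent v v≢r with dist-suc v v≢r
  ... | k , dv = ≤-trans (s≤s (dist-minimal (parent v) (pred (dist v)) (∧-trueˡ (parent-closer v v≢r))))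
                         (≤-reflexive (trans (cong (λ (j : ℕ) → suc (pred j)) dv) (sym dv)))

  parent-asym : ∀ v w → v ≢ r → w ≢ r → v ≡ parent w → w ≡ parent v → ⊥
  parent-asym v w v≢r w≢r v≡pw w≡pv = <-irrefl refl (<-trans
    (subst (λ x → dist x < dist w) (sym v≡pw) (dist-parent w w≢r))
    (subst (λ x → dist x < dist v) (sym w≡pv) (dist-parent v v≢r)))

  parentEdge : Fin n → Fin n → Fin n → Bool
  parentEdge c d v = not (v == r) ∧ ((c <F d) ∧ sameEdge c d v (parent v))

  parentEdge-nonroot : ∀ c d v → parentEdge c d v ≡ true → v ≢ r
  parentEdge-nonroot c d v p v≡r = contradictionᵇ (≡⇒== v≡r) (not-true⁻ (∧-trueˡ p))

  parentEdge-SameEdge : ∀ c d v → parentEdge c d v ≡ true → SameEdge c d v (parent v)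
  parentEdge-SameEdge c d v p = sameEdge⇒SameEdge c d v (parent v) (∧-trueʳ (c <F d) (∧-trueʳ (not (v == r)) p))

  parentEdge-unique : ∀ c d v w → parentEdge c d v ≡ true → parentEdge c d w ≡ true → v ≡ w
  parentEdge-unique c d v w pv pw with parentEdge-SameEdge c d v pv | parentEdge-SameEdge c d w pw
  ... | inj₁ (refl , _) | inj₁ (refl , _) = refl
  ... | inj₂ (_ , refl) | inj₂ (_ , refl) = refl
  ... | inj₁ (refl , w≡pv) | inj₂ (v≡pw , refl) =
    ⊥-elim (parent-asym v w (parentEdge-nonroot c d v pv) (parentEdge-nonroot c d w pw) v≡pw w≡pv)
  ... | inj₂ (w≡pv , refl) | inj₁ (refl , v≡pw) =
    ⊥-elim (parent-asym v w (parentEdge-nonroot c d v pv) (parentEdge-nonroot c d w pw) v≡pw w≡pv)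

  parentEdge⇒edge : ∀ c d v → parentEdge c d v ≡ true → (c <F d) ∧ Ad c d ≡ true
  parentEdge⇒edge c d v p = ∧-true (∧-trueˡ (∧-trueʳ (not (v == r)) p)) (edge (parentEdge-SameEdge c d v p))
    where
    v≢r : v ≢ r
    v≢r = parentEdge-nonroot c d v p
    edge : SameEdge c d v (parent v) → Ad c d ≡ true
    edge (inj₁ (refl , refl)) = trans (Ad-sym v (parent v)) (parent-adj v v≢r)
    edge (inj₂ (refl , refl)) = parent-adj v v≢r

  parentEdge-once-per-vertex : ∀ v → ∑F (λ c → ∑F (λ d → ⟦ parentEdge c d v ⟧)) ≡ ⟦ not (v == r) ⟧
  parentEdge-once-per-vertex v with true-or-false (not (v == r))
  ... | inj₁ v≢r rewrite v≢r = ∑-ordered-SameEdge≡1 v (parent v) v≢pv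
    where
    v≢pv : v ≢ parent v
    v≢pv v≡pv = contradictionᵇ (parent-adj v (λ v≡r → contradictionᵇ (≡⇒== v≡r) (not-true⁻ v≢r)))
                               (subst (λ x → Ad x v ≡ false) v≡pv (Ad-irrefl v))
  ... | inj₂ v≡r rewrite v≡r = ∑-zero (allFin n) (λ c → ∑-zero (allFin n) (λ d → refl))

  parentEdge-once-per-edge : ∀ c d → ∑F (λ v → ⟦ parentEdge c d v ⟧) ≤ ⟦ (c <F d) ∧ Ad c d ⟧
  parentEdge-once-per-edge c d with true-or-false ((c <F d) ∧ Ad c d)
  ... | inj₁ cd rewrite cd = ∑F-subsingleton (parentEdge c d) (parentEdge-unique c d)
  ... | inj₂ ¬cd rewrite ¬cd = ≤-reflexive (∑-zero (allFin n) (λ v → cong ⟦_⟧ (≢true⇒false λ p →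
                                 contradictionᵇ (parentEdge⇒edge c d v p) ¬cd)))

  edge-lower-bound : n ∸ 1 ≤ countPairs (λ i j → (i <F j) ∧ Ad i j)
  edge-lower-bound = begin
    n ∸ 1                                                  ≡⟨ ∑F-≢ r ⟨
    ∑F (λ v → ⟦ not (v == r) ⟧)                           ≡⟨ ∑-cong (allFin n) parentEdge-once-per-vertex ⟨
    ∑F (λ v → ∑F (λ c → ∑F (λ d → ⟦ parentEdge c d v ⟧))) ≡⟨ ∑-swap (allFin n) (allFin n) _ ⟩
    ∑F (λ c → ∑F (λ v → ∑F (λ d → ⟦ parentEdge c d v ⟧))) ≡⟨ ∑-cong (allFin n) (λ c → ∑-swap (allFin n) (allFin n) _) ⟩
    ∑F (λ c → ∑F (λ d → ∑F (λ v → ⟦ parentEdge c d v ⟧))) ≤⟨ ∑-mono (allFin n) (λ c → ∑-mono (allFin n) (parentEdge-once-per-edge c)) ⟩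
    ∑F (λ c → ∑F (λ d → ⟦ (c <F d) ∧ Ad c d ⟧))           ≡⟨ countPairs≡∑F∑F (λ i j → (i <F j) ∧ Ad i j) ⟨
    countPairs (λ i j → (i <F j) ∧ Ad i j)                 ∎
    where open ≤-Reasoning

∑M-product : ∀ {n} (P F G : Map n → Bool) (glue : Map n → Map n → Map n) (left right : Map n → Map n) →
  (∀ τ ρ → F τ ≡ true → G ρ ≡ true → P (glue τ ρ) ≡ true × left (glue τ ρ) ≡ τ × right (glue τ ρ) ≡ ρ) →
  (∀ σ → P σ ≡ true → F (left σ) ≡ true × G (right σ) ≡ true × glue (left σ) (right σ) ≡ σ) →
  ∑M (λ σ → ⟦ P σ ⟧) ≡ ∑M (λ τ → ⟦ F τ ⟧) * ∑M (λ ρ → ⟦ G ρ ⟧)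
∑M-product {n} P F G glue left right glue-in split-in = sym (begin
  ∑M (λ τ → ⟦ F τ ⟧) * ∑M (λ ρ → ⟦ G ρ ⟧)
    ≡⟨ ∑-*ʳ Ms _ (λ τ → ⟦ F τ ⟧) ⟨
  ∑M (λ τ → ⟦ F τ ⟧ * ∑M (λ ρ → ⟦ G ρ ⟧))
    ≡⟨ ∑-cong Ms (λ τ → trans (sym (∑-*ˡ Ms ⟦ F τ ⟧ _)) (∑-cong Ms (λ ρ → sym (⟦∧⟧ (F τ) (G ρ))))) ⟩
  ∑M (λ τ → ∑M (λ ρ → ⟦ F τ ∧ G ρ ⟧))
    ≡⟨ ∑-cong Ms (λ τ → ∑-cong Ms (λ ρ → ∑V-δ n (glue τ ρ) (λ _ → ⟦ F τ ∧ G ρ ⟧))) ⟨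
  ∑M (λ τ → ∑M (λ ρ → ∑M (λ σ → ⟦ σ ≟V glue τ ρ ⟧ * ⟦ F τ ∧ G ρ ⟧)))
    ≡⟨ trans (∑-cong Ms (λ τ → ∑-swap Ms Ms _)) (∑-swap Ms Ms _) ⟩
  ∑M (λ σ → ∑M (λ τ → ∑M (λ ρ → ⟦ σ ≟V glue τ ρ ⟧ * ⟦ F τ ∧ G ρ ⟧)))
    ≡⟨ ∑-cong Ms (λ σ → ∑-cong Ms (λ τ → ∑-cong Ms (λ ρ → begin
         ⟦ σ ≟V glue τ ρ ⟧ * ⟦ F τ ∧ G ρ ⟧                   ≡⟨ ⟦∧⟧ (σ ≟V glue τ ρ) _ ⟨
         ⟦ (σ ≟V glue τ ρ) ∧ (F τ ∧ G ρ) ⟧                   ≡⟨ cong ⟦_⟧ (glued⇔split σ τ ρ) ⟩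
         ⟦ (τ ≟V left σ) ∧ ((ρ ≟V right σ) ∧ P σ) ⟧          ≡⟨ ⟦∧⟧ (τ ≟V left σ) _ ⟩
         ⟦ τ ≟V left σ ⟧ * ⟦ (ρ ≟V right σ) ∧ P σ ⟧          ≡⟨ cong (⟦ τ ≟V left σ ⟧ *_) (⟦∧⟧ (ρ ≟V right σ) (P σ)) ⟩
         ⟦ τ ≟V left σ ⟧ * (⟦ ρ ≟V right σ ⟧ * ⟦ P σ ⟧)      ∎))) ⟩
  ∑M (λ σ → ∑M (λ τ → ∑M (λ ρ → ⟦ τ ≟V left σ ⟧ * (⟦ ρ ≟V right σ ⟧ * ⟦ P σ ⟧))))
    ≡⟨ ∑-cong Ms (λ σ → ∑-cong Ms (λ τ → ∑-*ˡ Ms ⟦ τ ≟V left σ ⟧ _)) ⟩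
  ∑M (λ σ → ∑M (λ τ → ⟦ τ ≟V left σ ⟧ * ∑M (λ ρ → ⟦ ρ ≟V right σ ⟧ * ⟦ P σ ⟧)))
    ≡⟨ ∑-cong Ms (λ σ → trans (∑V-δ n (left σ) _) (∑V-δ n (right σ) _)) ⟩
  ∑M (λ σ → ⟦ P σ ⟧) ∎)
  where
  open ≡-Reasoning
  Ms : List (Map n)
  Ms = allMaps n
  glued⇔split : ∀ σ τ ρ → (σ ≟V glue τ ρ) ∧ (F τ ∧ G ρ) ≡ (τ ≟V left σ) ∧ ((ρ ≟V right σ) ∧ P σ)
  glued⇔split σ τ ρ = bool-ext
    (λ e → let σ≡ = ≟V⇒≡ (∧-trueˡ e) ; Fτ∧Gρ = ∧-trueʳ (σ ≟V glue τ ρ) e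
               (P-glued , left-glued , right-glued) = glue-in τ ρ (∧-trueˡ Fτ∧Gρ) (∧-trueʳ (F τ) Fτ∧Gρ)
           in ∧-true (≡⇒≟V (sym (trans (cong left σ≡) left-glued)))
                     (∧-true (≡⇒≟V (sym (trans (cong right σ≡) right-glued))) (subst (λ x → P x ≡ true) (sym σ≡) P-glued)))
    (λ e → let τ≡ = ≟V⇒≡ (∧-trueˡ e) ; rest = ∧-trueʳ (τ ≟V left σ) e
               ρ≡ = ≟V⇒≡ (∧-trueˡ rest) ; Pσ = ∧-trueʳ (ρ ≟V right σ) rest
               (F-left , G-right , glued) = split-in σ Pσ
           in ∧-true (≡⇒≟V (trans (sym glued) (cong₂ glue (sym τ≡) (sym ρ≡))))
                     (∧-true (subst (λ x → F x ≡ true) (sym τ≡) F-left) (subst (λ x → G x ≡ true) (sym ρ≡) G-right)))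

-- Gluing two maps along a vertex set

idᵐ : ∀ {n} → Map n
idᵐ = tabulate id

glue : ∀ {n} → (Fin n → Bool) → Map n → Map n → Map n
glue S τ ρ = tabulate (λ i → if S i then lookup τ i else lookup ρ i)

module _ {n} (S : Fin n → Bool) where

  lookup-glue-in : ∀ τ ρ i → S i ≡ true → lookup (glue S τ ρ) i ≡ lookup τ i
  lookup-glue-in τ ρ i i∈S = trans (lookup∘tabulate _ i) (if-true _ _ i∈S)

  lookup-glue-out : ∀ τ ρ i → S i ≡ false → lookup (glue S τ ρ) i ≡ lookup ρ i
  lookup-glue-out τ ρ i i∉S = trans (lookup∘tabulate _ i) (if-false _ _ i∉S)

  glue-ext : ∀ (σ τ : Map n) → (∀ i → S i ≡ true → lookup σ i ≡ lookup τ i) →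
    (∀ i → S i ≡ false → lookup σ i ≡ lookup τ i) → σ ≡ τ
  glue-ext σ τ inside outside = lookup-ext λ i → [ inside i , outside i ]′ (true-or-false (S i))

  glue-restrictions : ∀ σ → glue S (glue S σ idᵐ) (glue S idᵐ σ) ≡ σ
  glue-restrictions σ = glue-ext _ σ
    (λ i i∈S → trans (lookup-glue-in (glue S σ idᵐ) (glue S idᵐ σ) i i∈S) (lookup-glue-in σ idᵐ i i∈S))
    (λ i i∉S → trans (lookup-glue-out (glue S σ idᵐ) (glue S idᵐ σ) i i∉S) (lookup-glue-out idᵐ σ i i∉S))

  restrict-glueˡ : ∀ τ ρ → (∀ i → S i ≡ false → lookup τ i ≡ i) → glue S (glue S τ ρ) idᵐ ≡ τ
  restrict-glueˡ τ ρ τ-fixes = glue-ext _ τ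
    (λ i i∈S → trans (lookup-glue-in (glue S τ ρ) idᵐ i i∈S) (lookup-glue-in τ ρ i i∈S))
    (λ i i∉S → trans (lookup-glue-out (glue S τ ρ) idᵐ i i∉S) (trans (lookup∘tabulate id i) (sym (τ-fixes i i∉S))))

  restrict-glueʳ : ∀ τ ρ → (∀ i → S i ≡ true → lookup ρ i ≡ i) → glue S idᵐ (glue S τ ρ) ≡ ρ
  restrict-glueʳ τ ρ ρ-fixes = glue-ext _ ρ
    (λ i i∈S → trans (lookup-glue-in idᵐ (glue S τ ρ) i i∈S) (trans (lookup∘tabulate id i) (sym (ρ-fixes i i∈S))))
    (λ i i∉S → trans (lookup-glue-out idᵐ (glue S τ ρ) i i∉S) (lookup-glue-out τ ρ i i∉S))

==-fixed : ∀ {n} (g : Map n) → Inj g → ∀ {p} → lookup g p ≡ p → ∀ x → (lookup g x == p) ≡ (x == p)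
==-fixed g inj gp x = bool-ext (λ e → ≡⇒== (inj x _ (trans (==⇒≡ e) (sym gp))))
                               (λ e → ≡⇒== (trans (cong (lookup g) (==⇒≡ e)) gp))

sameEdge-fixed : ∀ {n} (g : Map n) → Inj g → ∀ {p q} → lookup g p ≡ p → lookup g q ≡ q →
  ∀ x y → sameEdge (lookup g x) (lookup g y) p q ≡ sameEdge x y p q
sameEdge-fixed g inj gp gq x y =
  cong₂ _∨_ (cong₂ _∧_ (==-fixed g inj gp x) (==-fixed g inj gq y))
            (cong₂ _∧_ (==-fixed g inj gq x) (==-fixed g inj gp y))

sameEdge-congʳ : ∀ {n} {p′ q′ p q : Fin n} → SameEdge p′ q′ p q → ∀ x y → sameEdge x y p′ q′ ≡ sameEdge x y p q
sameEdge-congʳ (inj₁ (refl , refl)) x y = refl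
sameEdge-congʳ (inj₂ (refl , refl)) x y = sameEdge-swapʳ x y _ _

⁻¹ᵐ-preserves : ∀ {n} (R : Fin n → Fin n → Bool) (σ : Map n) → Inj σ →
  (∀ x y → R (lookup σ x) (lookup σ y) ≡ R x y) → ∀ x y → R (lookup (σ ⁻¹ᵐ) x) (lookup (σ ⁻¹ᵐ) y) ≡ R x y
⁻¹ᵐ-preserves R σ inj σ-pres x y = trans (sym (σ-pres _ _)) (cong₂ R (σσ⁻¹ x) (σσ⁻¹ y))
  where
  σσ⁻¹ : ∀ x → lookup σ (lookup (σ ⁻¹ᵐ) x) ≡ x
  σσ⁻¹ x = trans (cong (lookup σ) (lookup-⁻¹ᵐ σ x)) (lookup-preimage σ inj x)

lookup-idᵐ : ∀ {n} (i : Fin n) → lookup idᵐ i ≡ i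
lookup-idᵐ = lookup∘tabulate id

idᵐ-injective : ∀ {n} → Inj (idᵐ {n})
idᵐ-injective i k e = trans (sym (lookup-idᵐ i)) (trans e (lookup-idᵐ k))

module _ {n} (S : Fin n → Bool) where

  glue-injective : ∀ τ ρ → Inj τ → Inj ρ →
    (∀ i → S i ≡ true → S (lookup τ i) ≡ true) → (∀ i → S i ≡ false → S (lookup ρ i) ≡ false) →
    Inj (glue S τ ρ)
  glue-injective τ ρ τ-inj ρ-inj τ-in ρ-out i k e with true-or-false (S i) | true-or-false (S k)
  ... | inj₁ i∈S | inj₁ k∈S = τ-inj i k (trans (sym (lookup-glue-in S τ ρ i i∈S)) (trans e (lookup-glue-in S τ ρ k k∈S)))
  ... | inj₂ i∉S | inj₂ k∉S = ρ-inj i k (trans (sym (lookup-glue-out S τ ρ i i∉S)) (trans e (lookup-glue-out S τ ρ k k∉S)))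
  ... | inj₁ i∈S | inj₂ k∉S = contradictionᵇ (τ-in i i∈S)
    (subst (λ x → S x ≡ false) (trans (sym (lookup-glue-out S τ ρ k k∉S)) (trans (sym e) (lookup-glue-in S τ ρ i i∈S))) (ρ-out k k∉S))
  ... | inj₂ i∉S | inj₁ k∈S = contradictionᵇ (τ-in k k∈S)
    (subst (λ x → S x ≡ false) (trans (sym (lookup-glue-out S τ ρ i i∉S)) (trans e (lookup-glue-in S τ ρ k k∈S))) (ρ-out i i∉S))

  glue-preserves : (R : Fin n → Fin n → Bool) →
    (∀ x y → S x ≡ true → S y ≡ false → R x y ≡ false × R y x ≡ false) → ∀ τ ρ →
    (∀ x y → S x ≡ true → S y ≡ true → R (lookup τ x) (lookup τ y) ≡ R x y) →
    (∀ x y → S x ≡ false → S y ≡ false → R (lookup ρ x) (lookup ρ y) ≡ R x y) →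
    (∀ i → S i ≡ true → S (lookup τ i) ≡ true) → (∀ i → S i ≡ false → S (lookup ρ i) ≡ false) →
    ∀ x y → R (lookup (glue S τ ρ) x) (lookup (glue S τ ρ) y) ≡ R x y
  glue-preserves R separated τ ρ τ-pres ρ-pres τ-in ρ-out x y with true-or-false (S x) | true-or-false (S y)
  ... | inj₁ x∈S | inj₁ y∈S = trans (cong₂ R (lookup-glue-in S τ ρ x x∈S) (lookup-glue-in S τ ρ y y∈S)) (τ-pres x y x∈S y∈S)
  ... | inj₂ x∉S | inj₂ y∉S = trans (cong₂ R (lookup-glue-out S τ ρ x x∉S) (lookup-glue-out S τ ρ y y∉S)) (ρ-pres x y x∉S y∉S)
  ... | inj₁ x∈S | inj₂ y∉S = trans (cong₂ R (lookup-glue-in S τ ρ x x∈S) (lookup-glue-out S τ ρ y y∉S))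
    (trans (proj₁ (separated _ _ (τ-in x x∈S) (ρ-out y y∉S))) (sym (proj₁ (separated x y x∈S y∉S))))
  ... | inj₂ x∉S | inj₁ y∈S = trans (cong₂ R (lookup-glue-out S τ ρ x x∉S) (lookup-glue-in S τ ρ y y∈S))
    (trans (proj₂ (separated _ _ (τ-in y y∈S) (ρ-out x x∉S))) (sym (proj₂ (separated y x y∈S x∉S))))

  module _ {A : Fin n → Fin n → Bool} (σ : Map n) (σ-inj : Inj σ) (σ-S : ∀ i → S (lookup σ i) ≡ S i)
           (σ-pres : ∀ x y → A (lookup σ x) (lookup σ y) ≡ A x y) where

    IsAut-restrict : IsAut A S (glue S σ idᵐ)
    IsAut-restrict = record
      { fixes-outside = λ i i∉S → trans (lookup-glue-out S σ idᵐ i i∉S) (lookup-idᵐ i)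
      ; maps-into = λ i i∈S → subst (λ x → S x ≡ true) (sym (lookup-glue-in S σ idᵐ i i∈S)) (trans (σ-S i) i∈S)
      ; injective = glue-injective σ idᵐ σ-inj idᵐ-injective (λ i i∈S → trans (σ-S i) i∈S)
                      (λ i i∉S → subst (λ x → S x ≡ false) (sym (lookup-idᵐ i)) i∉S)
      ; preserves = λ x y x∈S y∈S → trans (cong₂ A (lookup-glue-in S σ idᵐ x x∈S) (lookup-glue-in S σ idᵐ y y∈S)) (σ-pres x y)
      }

    IsAut-restrictᶜ : IsAut A (not ∘ S) (glue S idᵐ σ)
    IsAut-restrictᶜ = record
      { fixes-outside = λ i i∈S → trans (lookup-glue-in S idᵐ σ i (not-false⁻ i∈S)) (lookup-idᵐ i)
      ; maps-into = λ i i∉S → subst (λ x → not (S x) ≡ true) (sym (lookup-glue-out S idᵐ σ i (not-true⁻ i∉S)))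
                                     (trans (cong not (σ-S i)) i∉S)
      ; injective = glue-injective idᵐ σ idᵐ-injective σ-inj
                      (λ i i∈S → subst (λ x → S x ≡ true) (sym (lookup-idᵐ i)) i∈S) (λ i i∉S → trans (σ-S i) i∉S)
      ; preserves = λ x y x∉S y∉S → trans (cong₂ A (lookup-glue-out S idᵐ σ x (not-true⁻ x∉S))
                                                   (lookup-glue-out S idᵐ σ y (not-true⁻ y∉S))) (σ-pres x y)
      }

SameEdge-sym : ∀ {n} {i j a b : Fin n} → SameEdge i j a b → SameEdge a b i j
SameEdge-sym (inj₁ (p , q)) = inj₁ (sym p , sym q)
SameEdge-sym (inj₂ (p , q)) = inj₂ (sym q , sym p)

sameEdge-stable : ∀ {n} (σ : Map n) → Inj σ → ∀ {a b} → sameEdge (lookup σ a) (lookup σ b) a b ≡ true →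
  ∀ x y → sameEdge (lookup σ x) (lookup σ y) a b ≡ sameEdge x y a b
sameEdge-stable σ inj {a} {b} σab x y = trans (sameEdge-preimage σ inj x y a b) (sameEdge-congʳ preimage-edge x y)
  where
  preimage-edge : SameEdge (preimage σ a) (preimage σ b) a b
  preimage-edge = SameEdge-sym (sameEdge⇒SameEdge a b _ _ (trans (sym (sameEdge-preimage σ inj a b a b)) σab))

adjMinus-sym : ∀ {n} (G : Graph n) a b (x y : Fin n) → adjMinus G a b x y ≡ adjMinus G a b y x
adjMinus-sym G a b x y = cong₂ (λ u v → u ∧ not v) (Graph.sym G x y) (sameEdge-swap x y a b)

adjMinus-irrefl : ∀ {n} (G : Graph n) a b (x : Fin n) → adjMinus G a b x x ≡ false
adjMinus-irrefl G a b x = ∧-falseˡ _ (irrefl G x)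

fixes-edge-endpoints : ∀ {n} (g : Map n) {v₋ v₊ a b} → SameEdge v₋ v₊ a b →
  lookup g v₋ ≡ v₋ → lookup g v₊ ≡ v₊ → lookup g a ≡ a × lookup g b ≡ b
fixes-edge-endpoints g (inj₁ (refl , refl)) g₋ g₊ = g₋ , g₊
fixes-edge-endpoints g (inj₂ (refl , refl)) g₋ g₊ = g₊ , g₋

∧-not-∨ : ∀ p q → (q ≡ true → p ≡ true) → p ≡ (p ∧ not q) ∨ q
∧-not-∨ p true q⇒p = trans (q⇒p refl) (sym (∨-comm _ true))
∧-not-∨ true false _ = refl
∧-not-∨ false false _ = refl

module SeparatingEdge {n} (G : Graph n) (r : Fin n) {a b : Fin n} (ab : adj G a b ≡ true)
  {v₋ v₊ : Fin n} (endpoints : SameEdge v₋ v₊ a b)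
  (v₋∈T : Sminus G r a b v₋ ≡ true) (v₊∉T : Sminus G r a b v₊ ≡ false) where

  private
    Am : Fin n → Fin n → Bool
    Am = adjMinus G a b
    T U : Fin n → Bool
    T = Sminus G r a b
    U = Splus G r a b
  open Reach Am

  root∈T : T r ≡ true
  root∈T = reach-refl n r

  separated : ∀ x y → T x ≡ true → T y ≡ false → Am x y ≡ false × Am y x ≡ false
  separated x y x∈T y∉T = xy , trans (adjMinus-sym G a b y x) xy
    where
    xy : Am x y ≡ false
    xy = ≢true⇒false λ e → contradictionᵇ (reachable-step r x y x∈T e) y∉T

  Am-preserved : ∀ σ → (∀ x y → adj G (lookup σ x) (lookup σ y) ≡ adj G x y) →
    (∀ x y → sameEdge (lookup σ x) (lookup σ y) a b ≡ sameEdge x y a b) →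
    ∀ x y → Am (lookup σ x) (lookup σ y) ≡ Am x y
  Am-preserved σ adj-pres edge-pres x y = cong₂ (λ u v → u ∧ not v) (adj-pres x y) (edge-pres x y)

  adj-preserved : ∀ σ → (∀ x y → Am (lookup σ x) (lookup σ y) ≡ Am x y) →
    (∀ x y → sameEdge (lookup σ x) (lookup σ y) a b ≡ sameEdge x y a b) →
    ∀ x y → adj G (lookup σ x) (lookup σ y) ≡ adj G x y
  adj-preserved σ Am-pres edge-pres x y =
    trans (adj≡ (lookup σ x) (lookup σ y)) (trans (cong₂ _∨_ (Am-pres x y) (edge-pres x y)) (sym (adj≡ x y)))
    where
    adj≡ : ∀ x y → adj G x y ≡ Am x y ∨ sameEdge x y a b
    adj≡ x y = ∧-not-∨ (adj G x y) (sameEdge x y a b) (SameEdge⇒adj G ab ∘ sameEdge⇒SameEdge x y a b)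

  T-preserved : ∀ σ → (∀ x y → Am (lookup σ x) (lookup σ y) ≡ Am x y) → lookup σ r ≡ r →
    ∀ x → T x ≡ true → T (lookup σ x) ≡ true
  T-preserved σ Am-pres σr x x∈T = subst (λ z → reach n Am z (lookup σ x) ≡ true) σr (reach-image σ Am-pres n r x x∈T)

  T-invariant : ∀ σ → Inj σ → (∀ x y → Am (lookup σ x) (lookup σ y) ≡ Am x y) → lookup σ r ≡ r →
    ∀ x → T (lookup σ x) ≡ T x
  T-invariant σ inj Am-pres σr x = bool-ext
    (λ σx∈T → subst (λ z → T z ≡ true) (trans (lookup-⁻¹ᵐ σ _) (preimage-lookup σ inj x))
                    (T-preserved (σ ⁻¹ᵐ) (⁻¹ᵐ-preserves Am σ inj Am-pres) σ⁻¹r _ σx∈T))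
    (T-preserved σ Am-pres σr x)
    where
    σ⁻¹r : lookup (σ ⁻¹ᵐ) r ≡ r
    σ⁻¹r = trans (lookup-⁻¹ᵐ σ r) (trans (cong (preimage σ) (sym σr)) (preimage-lookup σ inj r))

  Stab₋ Stab₊ : Map n → Bool
  Stab₋ = stabilizer (autR-isMapGroup Am T r) v₋
  Stab₊ = stabilizer (aut-isMapGroup Am U) v₊

  glue-stabilizers : ∀ τ ρ → Stab₋ τ ≡ true → Stab₊ ρ ≡ true →
    edgeStabilizer G r a b (glue T τ ρ) ≡ true × glue T (glue T τ ρ) idᵐ ≡ τ × glue T idᵐ (glue T τ ρ) ≡ ρ
  glue-stabilizers τ ρ τ∈ ρ∈ =
    ∧-true (IsAut⇒isAutROn g-aut (trans (lookup-glue-in T τ ρ r root∈T) τr))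
           (trans (sameEdge-fixed g g-inj (proj₁ g-ab) (proj₂ g-ab) a b) (sameEdge-refl a b)) ,
    restrict-glueˡ T τ ρ τ.fixes-outside ,
    restrict-glueʳ T τ ρ (λ i i∈T → ρ.fixes-outside i (cong not i∈T))
    where
    τ-aut : IsAut Am T τ
    τ-aut = proj₁ (isAutROn⇒IsAut Am T r τ (∧-trueˡ τ∈))
    τr : lookup τ r ≡ r
    τr = proj₂ (isAutROn⇒IsAut Am T r τ (∧-trueˡ τ∈))
    ρ-aut : IsAut Am U ρ
    ρ-aut = isAutOn⇒IsAut Am U ρ (∧-trueˡ ρ∈)
    module τ = IsAut τ-aut
    module ρ = IsAut ρ-aut
    ρ-out : ∀ i → T i ≡ false → T (lookup ρ i) ≡ false
    ρ-out i i∉T = not-true⁻ (ρ.maps-into i (not-true i∉T))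
    g : Map n
    g = glue T τ ρ
    g-inj : Inj g
    g-inj = glue-injective T τ ρ τ.injective ρ.injective τ.maps-into ρ-out
    g-ab : lookup g a ≡ a × lookup g b ≡ b
    g-ab = fixes-edge-endpoints g endpoints
      (trans (lookup-glue-in T τ ρ v₋ v₋∈T) (==⇒≡ (∧-trueʳ (isAutROn Am T r τ) τ∈)))
      (trans (lookup-glue-out T τ ρ v₊ v₊∉T) (==⇒≡ (∧-trueʳ (isAutOn Am U ρ) ρ∈)))
    g-Am : ∀ x y → Am (lookup g x) (lookup g y) ≡ Am x y
    g-Am = glue-preserves T Am separated τ ρ τ.preserves
      (λ x y x∉T y∉T → ρ.preserves x y (not-true x∉T) (not-true y∉T)) τ.maps-into ρ-out
    g-aut : IsAut (adj G) full g
    g-aut = record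
      { fixes-outside = λ _ ()
      ; maps-into = λ _ _ → refl
      ; injective = g-inj
      ; preserves = λ x y _ _ → adj-preserved g g-Am (sameEdge-fixed g g-inj (proj₁ g-ab) (proj₂ g-ab)) x y
      }

  split-stabilizer : ∀ σ → edgeStabilizer G r a b σ ≡ true →
    Stab₋ (glue T σ idᵐ) ≡ true × Stab₊ (glue T idᵐ σ) ≡ true × glue T (glue T σ idᵐ) (glue T idᵐ σ) ≡ σ
  split-stabilizer σ σ∈ =
    ∧-true (IsAut⇒isAutROn (IsAut-restrict T σ σ-inj σ-T σ-Am) (trans (lookup-glue-in T σ idᵐ r root∈T) σr))
           (≡⇒== (trans (lookup-glue-in T σ idᵐ v₋ v₋∈T) (proj₁ σ-fixes))) ,
    ∧-true (IsAut⇒isAutOn (IsAut-restrictᶜ T σ σ-inj σ-T σ-Am))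
           (≡⇒== (trans (lookup-glue-out T idᵐ σ v₊ v₊∉T) (proj₂ σ-fixes))) ,
    glue-restrictions T σ
    where
    σ-aut : IsAut (adj G) full σ
    σ-aut = proj₁ (isAutROn⇒IsAut (adj G) full r σ (∧-trueˡ σ∈))
    σr : lookup σ r ≡ r
    σr = proj₂ (isAutROn⇒IsAut (adj G) full r σ (∧-trueˡ σ∈))
    σ-inj : Inj σ
    σ-inj = IsAut.injective σ-aut
    σ-edge : ∀ x y → sameEdge (lookup σ x) (lookup σ y) a b ≡ sameEdge x y a b
    σ-edge = sameEdge-stable σ σ-inj (∧-trueʳ (isAutROn (adj G) full r σ) σ∈)
    σ-Am : ∀ x y → Am (lookup σ x) (lookup σ y) ≡ Am x y
    σ-Am = Am-preserved σ (λ x y → IsAut.preserves σ-aut x y refl refl) σ-edge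
    σ-T : ∀ x → T (lookup σ x) ≡ T x
    σ-T = T-invariant σ σ-inj σ-Am σr
    σ-v₋v₊ : SameEdge (lookup σ v₋) (lookup σ v₊) v₋ v₊
    σ-v₋v₊ = SameEdge-trans
      (sameEdge⇒SameEdge _ _ a b (trans (σ-edge v₋ v₊) (SameEdge⇒sameEdge v₋ v₊ a b endpoints)))
      (SameEdge-sym endpoints)
    -- σ cannot swap v₋ and v₊, since it preserves T.
    σ-fixes : lookup σ v₋ ≡ v₋ × lookup σ v₊ ≡ v₊
    σ-fixes with σ-v₋v₊
    ... | inj₁ fixed = fixed
    ... | inj₂ (σv₋≡v₊ , _) = contradictionᵇ (trans (sym (cong T σv₋≡v₊)) (trans (σ-T v₋) v₋∈T)) v₊∉T

  edgeStabilizer-product : ∑M (λ σ → ⟦ edgeStabilizer G r a b σ ⟧) ≡ ∑M (λ τ → ⟦ Stab₋ τ ⟧) * ∑M (λ ρ → ⟦ Stab₊ ρ ⟧)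
  edgeStabilizer-product = ∑M-product (edgeStabilizer G r a b) Stab₋ Stab₊ (glue T) (λ σ → glue T σ idᵐ) (glue T idᵐ)
    glue-stabilizers split-stabilizer

  edge-vertex-identity : mEdge G r a b * (AutR Am T r * AutU Am U)
                       ≡ (mVert Am T r v₋ * nVert Am U v₊) * AutR (adj G) full r
  edge-vertex-identity = begin
    mEdge G r a b * (AutR Am T r * AutU Am U)
      ≡⟨ cong (mEdge G r a b *_) (cong₂ _*_ orbit-stabilizer₋ orbit-stabilizer₊) ⟨
    mEdge G r a b * ((mVert Am T r v₋ * s₋) * (nVert Am U v₊ * s₊))
      ≡⟨ rearrange (mEdge G r a b) (mVert Am T r v₋) (nVert Am U v₊) s₋ s₊ ⟩
    (mVert Am T r v₋ * nVert Am U v₊) * (mEdge G r a b * (s₋ * s₊))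
      ≡⟨ cong ((mVert Am T r v₋ * nVert Am U v₊) *_) (trans (cong (mEdge G r a b *_) (sym edgeStabilizer-product))
                                                            (edge-orbit-stabilizer G r ab)) ⟩
    (mVert Am T r v₋ * nVert Am U v₊) * AutR (adj G) full r ∎
    where
    open ≡-Reasoning
    s₋ s₊ : ℕ
    s₋ = ∑M (λ τ → ⟦ Stab₋ τ ⟧)
    s₊ = ∑M (λ ρ → ⟦ Stab₊ ρ ⟧)
    orbit-stabilizer₋ : mVert Am T r v₋ * s₋ ≡ AutR Am T r
    orbit-stabilizer₋ = trans
      (vertex-orbit-stabilizer (autR-isMapGroup Am T r) T
        (λ σ w σ∈ → IsAut.fixes-outside (proj₁ (isAutROn⇒IsAut Am T r σ σ∈)) w) v₋ v₋∈T)
      (sym (countMaps≡∑M (isAutROn Am T r)))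
    orbit-stabilizer₊ : nVert Am U v₊ * s₊ ≡ AutU Am U
    orbit-stabilizer₊ = trans
      (vertex-orbit-stabilizer (aut-isMapGroup Am U) U
        (λ σ w σ∈ → IsAut.fixes-outside (isAutOn⇒IsAut Am U σ σ∈) w) v₊ (not-true v₊∉T))
      (sym (countMaps≡∑M (isAutOn Am U)))
    rearrange : ∀ e m k x y → e * ((m * x) * (k * y)) ≡ (m * k) * (e * (x * y))
    rearrange = solve 5 (λ e m k x y → e :* ((m :* x) :* (k :* y)) := (m :* k) :* (e :* (x :* y))) refl
      where open +-*-Solver

⟦∧⟧-split : ∀ x y z → (z ≡ true → y ≡ true) → ⟦ x ∧ y ⟧ ≡ ⟦ x ∧ (y ∧ not z) ⟧ + ⟦ x ∧ z ⟧
⟦∧⟧-split false y z _ = refl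
⟦∧⟧-split true y true z⇒y rewrite z⇒y refl = refl
⟦∧⟧-split true true false _ = refl
⟦∧⟧-split true false false _ = refl

module TreeEdge {n} (G : Graph n) (r : Fin n) {a b : Fin n} (ab : adj G a b ≡ true) (tree : IsTree G) where
  private
    Am : Fin n → Fin n → Bool
    Am = adjMinus G a b
    T : Fin n → Bool
    T = Sminus G r a b
  open Reach

  edgeCount-minus : countPairs (λ i j → (i <F j) ∧ adj G i j) ≡ countPairs (λ i j → (i <F j) ∧ Am i j) + 1
  edgeCount-minus = begin
    countPairs (λ i j → (i <F j) ∧ adj G i j)
      ≡⟨ countPairs≡∑F∑F (λ i j → (i <F j) ∧ adj G i j) ⟩
    ∑F (λ c → ∑F (λ d → ⟦ (c <F d) ∧ adj G c d ⟧))
      ≡⟨ ∑-cong (allFin n) (λ c → trans (∑-cong (allFin n) (λ d → ⟦∧⟧-split (c <F d) (adj G c d) (sameEdge c d a b)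
                                                              (SameEdge⇒adj G ab ∘ sameEdge⇒SameEdge c d a b)))
                                          (∑-+ (allFin n) _ _)) ⟩
    ∑F (λ c → ∑F (λ d → ⟦ (c <F d) ∧ Am c d ⟧) + ∑F (λ d → ⟦ (c <F d) ∧ sameEdge c d a b ⟧))
      ≡⟨ ∑-+ (allFin n) _ _ ⟩
    ∑F (λ c → ∑F (λ d → ⟦ (c <F d) ∧ Am c d ⟧)) + ∑F (λ c → ∑F (λ d → ⟦ (c <F d) ∧ sameEdge c d a b ⟧))
      ≡⟨ cong₂ _+_ (sym (countPairs≡∑F∑F (λ i j → (i <F j) ∧ Am i j))) (∑-ordered-SameEdge≡1 a b (adj⇒≢ G ab)) ⟩
    countPairs (λ i j → (i <F j) ∧ Am i j) + 1 ∎
    where open ≡-Reasoning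

  -- The only edge of G missing from G − e joins two vertices on the same side.
  T-closed : T a ≡ T b → ∀ i j → T i ≡ true → adj G i j ≡ true → T j ≡ true
  T-closed Ta≡Tb i j i∈T ij with true-or-false (sameEdge i j a b)
  ... | inj₂ not-e = reachable-step Am r i j i∈T (∧-true ij (not-true not-e))
  ... | inj₁ e with sameEdge⇒SameEdge i j a b e
  ...   | inj₁ (refl , refl) = trans (sym Ta≡Tb) i∈T
  ...   | inj₂ (refl , refl) = trans Ta≡Tb i∈T

  endpoints-separated : T a ≢ T b
  endpoints-separated Ta≡Tb = 1+n≰n (begin-strict
    countPairs (λ i j → (i <F j) ∧ Am i j)      <⟨ ≤-reflexive (sym (+-comm _ 1)) ⟩
    countPairs (λ i j → (i <F j) ∧ Am i j) + 1 ≡⟨ sym edgeCount-minus ⟩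
    edgeCount G                                 ≡⟨ proj₂ tree ⟩
    n ∸ 1                                       ≤⟨ ConnectedEdgeBound.edge-lower-bound Am (adjMinus-sym G a b) (adjMinus-irrefl G a b) r all-in-T ⟩
    countPairs (λ i j → (i <F j) ∧ Am i j)      ∎)
    where
    open ≤-Reasoning
    all-in-T : ∀ v → reachable Am r v ≡ true
    all-in-T v = reach-closed (adj G) T r (reach-refl Am n r) (T-closed Ta≡Tb) n v (proj₁ tree r v)

  vminus-vplus : SameEdge (vminus G r a b) (vplus G r a b) a b
  vminus-vplus with true-or-false (T a)
  ... | inj₁ a∈T = inj₁ (if-true a b a∈T , if-true b a a∈T)
  ... | inj₂ a∉T = inj₂ (if-false a b a∉T , if-false b a a∉T)

  vminus∈T : T (vminus G r a b) ≡ true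
  vminus∈T with true-or-false (T a)
  ... | inj₁ a∈T = subst (λ v → T v ≡ true) (sym (if-true a b a∈T)) a∈T
  ... | inj₂ a∉T = subst (λ v → T v ≡ true) (sym (if-false a b a∉T))
                         (¬-not (λ b∉T → endpoints-separated (trans a∉T (sym b∉T))))

  vplus∉T : T (vplus G r a b) ≡ false
  vplus∉T with true-or-false (T a)
  ... | inj₁ a∈T = subst (λ v → T v ≡ false) (sym (if-true b a a∈T))
                         (≢true⇒false (λ b∈T → endpoints-separated (trans a∈T (sym b∈T))))
  ... | inj₂ a∉T = subst (λ v → T v ≡ false) (sym (if-false b a a∉T)) a∉T

lemma4p5 : (n : ℕ) (G : Graph n) (r : Fin n) → IsTree G →
    (a b : Fin n) → adj G a b ≡ true →
    mEdge G r a b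
      * (AutR (adjMinus G a b) (Sminus G r a b) r * AutU (adjMinus G a b) (Splus G r a b))
    ≡ (mVert (adjMinus G a b) (Sminus G r a b) r (vminus G r a b)
         * nVert (adjMinus G a b) (Splus G r a b) (vplus G r a b))
      * AutR (adj G) full r
lemma4p5 n G r tree a b ab = SeparatingEdge.edge-vertex-identity G r ab vminus-vplus vminus∈T vplus∉T
  where open TreeEdge G r ab tree
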